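{- Let $M$ be a matroid of rank $n$ on $d$ points and let $w=(p_1,\ldots,p_d)$ be an ordering of its points such that $\{p_1,\ldots,p_n\}$ is a basis of $M$. Then $$\dim_{\mathrm{naive}}(\Gamma_M)\leq\sum_{i=1}^d\tau_i,$$ and equality holds if $M$ is an elementary split matroid.
   Context: Subspaces of a matroid $N$ (of rank $k$): circuits of $N$ of size at most $k$ are grouped by $C_1\sim C_2\iff\mathrm{cl}(C_1)=\mathrm{cl}(C_2)$; each class $l$ is a subspace, $\mathrm{rank}(l)$ is the rank of its circuits, $l$ is identified with the set of points lying in some circuit of the class, $|l|$ its cardinality; $\mathcal{L}_N$ is the set of subspaces. Naive dimension: $\dim_{\mathrm{naive}}(\Gamma_M)=nd-\sum_{l\in\mathcal{L}_M}(|l|-\mathrm{rank}(l))(n-\mathrm{rank}(l))$. For the ordering $w$, $M_w[i]$ is the restriction of $M$ to $\{p_1,\ldots,p_i\}$, $(\mathcal{L}_w[i])_{p_i}$ is the set of subspaces of $M_w[i]$ containing $p_i$, and $\tau_i=\sum_{l\in(\mathcal{L}_w[i])_{p_i}}\mathrm{rank}(l)-n\big(|(\mathcal{L}_w[i])_{p_i}|-1\big)$. An elementary split matroid is one of the form: for subsets $H_1,\ldots,H_q$ of the ground set $[d]$ and positive integers $r_i$ with $|H_i\cap H_j|\leq r_i+r_j-n$ ($i\neq j$), $|[d]\setminus H_i|\geq n-r_i$, $r_i\leq n-1$, $|H_i|\geq r_i+1$, the matroid with independent sets $\{X:|X|\leq n,\ |X\cap H_i|\leq r_i\ \forall i\}$.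 -}

module Defs where

open import Data.Bool using (Bool; true; false; _∧_; _∨_; not; T; if_then_else_)
open import Data.Nat as ℕ using (ℕ; zero; suc; _≤_; _<_; _≡ᵇ_; _≤ᵇ_; _<ᵇ_; _⊔_)
open import Data.Integer as ℤ using (ℤ; +_; _-_; _*_)
open import Data.Fin using (Fin; toℕ)
open import Data.Fin.Subset using (Subset; ⊥; ⊤; ⁅_⁆; _∈_; _∉_; _⊆_; _∪_; _∩_; ∁; ∣_∣; ⋃)
open import Data.Fin.Permutation using (Permutation′; _⟨$⟩ʳ_)
open import Data.Vec using (Vec; []; _∷_; lookup; tabulate; zipWith)
open import Data.List as List using (List; []; _∷_; _++_; filter; map; foldr; length; allFin)
open import Data.Product using (Σ; ∃; _×_; _,_)
open import Relation.Nullary using (¬_)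
open import Relation.Unary using (Decidable)
open import Relation.Nullary.Decidable using (Dec; yes; no)
open import Relation.Binary.PropositionalEquality using (_≡_)

private
  variable
    d : ℕ

andAll : ∀ {m} → Vec Bool m → Bool
andAll []       = true
andAll (b ∷ bs) = b ∧ andAll bs

_⊆ᵇ_ : Subset d → Subset d → Bool
X ⊆ᵇ Y = andAll (zipWith (λ a b → not a ∨ b) X Y)

_==ˢ_ : Subset d → Subset d → Bool
X ==ˢ Y = (X ⊆ᵇ Y) ∧ (Y ⊆ᵇ X)

allSubsets : (d : ℕ) → List (Subset d)
allSubsets zero    = [] ∷ []
allSubsets (suc d) = map (true ∷_) (allSubsets d) ++ map (false ∷_) (allSubsets d)

filterᵇ : ∀ {A : Set} → (A → Bool) → List A → List A
filterᵇ p []       = []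
filterᵇ p (x ∷ xs) = if p x then x ∷ filterᵇ p xs else filterᵇ p xs

allᵇ : ∀ {A : Set} → (A → Bool) → List A → Bool
allᵇ p = foldr (λ x b → p x ∧ b) true

anyᵇ : ∀ {A : Set} → (A → Bool) → List A → Bool
anyᵇ p = foldr (λ x b → p x ∨ b) false

maxList : List ℕ → ℕ
maxList = foldr _⊔_ 0

sumℤ : List ℤ → ℤ
sumℤ = foldr ℤ._+_ (+ 0)

record Matroid (d : ℕ) : Set where
  field
    indep   : Subset d → Bool
    indep-∅ : T (indep ⊥)
    hered   : ∀ X Y → Y ⊆ X → T (indep X) → T (indep Y)
    augment : ∀ X Y → T (indep X) → T (indep Y) → ∣ X ∣ < ∣ Y ∣ →
              ∃ λ x → x ∈ Y × x ∉ X × T (indep (X ∪ ⁅ x ⁆))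

open Matroid public

Indep : Matroid d → Subset d → Set
Indep M X = T (indep M X)

rk : Matroid d → Subset d → ℕ
rk {d} M X = maxList (map ∣_∣ (filterᵇ (λ Y → (Y ⊆ᵇ X) ∧ indep M Y) (allSubsets d)))

rank : Matroid d → ℕ
rank M = rk M ⊤

IsBasis : Matroid d → Subset d → Set
IsBasis M B = Indep M B × (∀ x → x ∉ B → ¬ Indep M (B ∪ ⁅ x ⁆))

-- Everything below is for the restriction M|E of M to a ground set E ⊆ Fin d.
-- (Independent sets of M|E = independent sets of M contained in E.)

isCircuit : Matroid d → Subset d → Subset d → Bool
isCircuit {d} M E C =
  (C ⊆ᵇ E) ∧ not (indep M C) ∧
  allᵇ (λ Y → not ((Y ⊆ᵇ C) ∧ not (Y ==ˢ C)) ∨ indep M Y) (allSubsets d)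

cl : Matroid d → Subset d → Subset d → Subset d
cl M E X = tabulate (λ x → lookup E x ∧ (rk M (X ∪ ⁅ x ⁆) ≡ᵇ rk M X))

smallCircuits : Matroid d → Subset d → List (Subset d)
smallCircuits {d} M E =
  filterᵇ (λ C → isCircuit M E C ∧ (∣ C ∣ ≤ᵇ rk M E)) (allSubsets d)

-- Subspaces of M|E: equivalence classes of small circuits under
-- C₁ ∼ C₂ ⇔ cl C₁ = cl C₂.  A class is indexed by the common closure F.
subspaces : Matroid d → Subset d → List (Subset d)
subspaces {d} M E =
  filterᵇ (λ F → anyᵇ (λ C → cl M E C ==ˢ F) (smallCircuits M E)) (allSubsets d)

classCircuits : Matroid d → Subset d → Subset d → List (Subset d)
classCircuits M E F = filterᵇ (λ C → cl M E C ==ˢ F) (smallCircuits M E)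

points : Matroid d → Subset d → Subset d → Subset d
points M E F = ⋃ (classCircuits M E F)

-- rank of the subspace: the rank of its circuits (all circuits of a class
-- have the same rank; we take the maximum over them)
subRank : Matroid d → Subset d → Subset d → ℕ
subRank M E F = maxList (map (rk M) (classCircuits M E F))

subSize : Matroid d → Subset d → Subset d → ℕ
subSize M E F = ∣ points M E F ∣

dimNaive : Matroid d → ℕ → ℤ
dimNaive {d} M n =
  + (n ℕ.* d) -
  sumℤ (map (λ F → (+ subSize M ⊤ F - + subRank M ⊤ F) * (+ n - + subRank M ⊤ F))
            (subspaces M ⊤))

-- ordering w = (p₁,…,p_d) with p_{j+1} = w ⟨$⟩ʳ j  (j : Fin d, 0-based)

firstPoints : Permutation′ d → ℕ → Subset d
firstPoints {d} w k =
  ⋃ (map (λ j → ⁅ w ⟨$⟩ʳ j ⁆) (filterᵇ (λ j → toℕ j <ᵇ k) (allFin d)))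

-- τ for the point p = w ⟨$⟩ʳ i, with M_w = M restricted to the first (toℕ i + 1) points
τ : Matroid d → ℕ → Permutation′ d → Fin d → ℤ
τ M n w i =
  sumℤ (map (λ F → + subRank M E F) Lp) - + n * (+ length Lp - + 1)
  where
    E  = firstPoints w (suc (toℕ i))
    Lp = filterᵇ (λ F → lookup (points M E F) (w ⟨$⟩ʳ i)) (subspaces M E)

sumτ : Matroid d → ℕ → Permutation′ d → ℤ
sumτ {d} M n w = sumℤ (map (τ M n w) (allFin d))

IsElementarySplit : Matroid d → ℕ → Set
IsElementarySplit {d} M n =
  Σ ℕ λ q → Σ (Fin q → Subset d) λ H → Σ (Fin q → ℕ) λ r →
    (∀ i → 1 ≤ r i) ×
    (∀ i j → ¬ (i ≡ j) → ∣ H i ∩ H j ∣ ℕ.+ n ≤ r i ℕ.+ r j) ×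
    (∀ i → n ≤ ∣ ∁ (H i) ∣ ℕ.+ r i) ×
    (∀ i → r i ≤ n ℕ.∸ 1) ×
    (∀ i → suc (r i) ≤ ∣ H i ∣) ×
    (∀ X → (Indep M X → (∣ X ∣ ≤ n × (∀ i → ∣ X ∩ H i ∣ ≤ r i)))
         × ((∣ X ∣ ≤ n × (∀ i → ∣ X ∩ H i ∣ ≤ r i)) → Indep M X))

-- Both sides are n d minus a sum over subspaces.  Writing τ_i = n − Σ (n − rank l′) over the subspaces
-- l′ of M_w[i] through p_i, each such l′ is the trace on {p₁,…,p_i} of exactly one subspace l of M (the
-- closure of any of its circuits), of the same rank; call i a witness for l.  Exchanging the sums, the
-- inequality becomes Σ_l (n − rank l)·#witnesses(l) ≤ Σ_l (n − rank l)(|l| − rank l).  At a witness i,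
-- p_i ∈ l and more than rank l points of l lie among p₁,…,p_i, since a circuit exceeds its rank; as i
-- runs over l, the number of points of l seen so far exceeds rank l exactly |l| − rank l times.
-- In an elementary split matroid every subspace is some H_j of rank r_j and any r_j + 1 points of H_j
-- form a circuit, so each of these indices is a witness; the basis hypothesis makes that circuit small
-- in M_w[i].

module Submission where

open import Defs
open import Data.Bool using (Bool; true; false; _∧_; _∨_; not; T; if_then_else_)
open import Data.Bool.Properties using (T-∧; T-∨; T-≡) renaming (_≟_ to _≟ᵇ_)
open import Data.Empty using (⊥-elim)
open import Data.Fin using (Fin; toℕ) renaming (zero to fzero; suc to fsuc)
open import Data.Fin.Permutation using (Permutation′; _⟨$⟩ʳ_; _⟨$⟩ˡ_; inverseˡ; inverseʳ)
open import Data.Fin.Properties using (¬∀⟶∃¬) renaming (_≟_ to _≟ᶠ_)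
open import Data.Fin.Subset using (Subset; ⊥; ⊤; ⁅_⁆; _∈_; _∉_; _⊆_; _∪_; _∩_; ∣_∣; ⋃)
open import Data.Fin.Subset.Properties
open import Data.Integer as ℤ using (ℤ)
import Data.Integer.Properties as ℤ
open import Data.Integer.Solver using (module +-*-Solver)
open import Data.List using (List; []; _∷_; _++_; map; length; allFin)
open import Data.List.Membership.Propositional using () renaming (_∈_ to _∈ˡ_)
open import Data.List.Membership.Propositional.Properties using (∈-map⁺; ∈-map⁻; ∈-++⁺ˡ; ∈-++⁺ʳ; ∈-allFin)
open import Data.List.Properties using (map-++; map-tabulate; length-tabulate)
open import Data.List.Relation.Unary.All as All using (All; []; _∷_)
open import Data.List.Relation.Unary.AllPairs using ([]; _∷_)
open import Data.List.Relation.Unary.Any using (here; there)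
open import Data.List.Relation.Unary.Unique.Propositional using (Unique)
open import Data.List.Relation.Unary.Unique.Propositional.Properties using (allFin⁺)
open import Data.Nat using (ℕ; zero; suc; _+_; _*_; _∸_; _≤_; _<_; z≤n; s≤s; _⊔_; _≤ᵇ_; _<ᵇ_; _≡ᵇ_)
open import Data.Nat.ListAction using (sum)
open import Data.Nat.ListAction.Properties using (sum-++)
open import Data.Nat.Properties
open import Algebra.Properties.CommutativeSemigroup +-commutativeSemigroup using (interchange)
open import Data.Product using (Σ; ∃; _×_; _,_; proj₁; proj₂)
open import Data.Sum using (_⊎_; inj₁; inj₂; [_,_]′)
open import Data.Unit using (tt)
open import Data.Vec using ([]; _∷_; lookup; here; there)
open import Data.Vec.Properties using ([]=⇒lookup; lookup⇒[]=; ∷-injectiveˡ; ∷-injectiveʳ; lookup∘tabulate; ≡-dec)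
open import Function using (_∘_; case_of_; Equivalence)
open import Relation.Nullary using (¬_; yes; no)
open import Relation.Binary.PropositionalEquality
  using (_≡_; _≢_; refl; sym; trans; cong; cong₂; subst; subst₂; module ≡-Reasoning)

private variable d : ℕ

T-∧⁺ : ∀ {a b} → T a → T b → T (a ∧ b)
T-∧⁺ p q = Equivalence.from T-∧ (p , q)

T-∧⁻ : ∀ {a b} → T (a ∧ b) → T a × T b
T-∧⁻ = Equivalence.to T-∧

T-∨⁻ : ∀ {a b} → T (a ∨ b) → T a ⊎ T b
T-∨⁻ = Equivalence.to T-∨

T-∨⁺ : ∀ {a b} → T a ⊎ T b → T (a ∨ b)
T-∨⁺ = Equivalence.from T-∨

T-not⁺ : ∀ {a} → ¬ T a → T (not a)
T-not⁺ {false} _ = tt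
T-not⁺ {true}  h = h tt

T-not⁻ : ∀ {a} → T (not a) → ¬ T a
T-not⁻ {false} _ ()

≡true⇒T : ∀ {a} → a ≡ true → T a
≡true⇒T = Equivalence.from T-≡

lookup⇒∈ : ∀ {x : Fin d} {X : Subset d} → T (lookup X x) → x ∈ X
lookup⇒∈ {x = x} {X} h with lookup X x in eq
... | true = lookup⇒[]= x X eq

∈⇒lookup : ∀ {x : Fin d} {X : Subset d} → x ∈ X → T (lookup X x)
∈⇒lookup h rewrite []=⇒lookup h = tt

⊆ᵇ⇒⊆ : ∀ (X Y : Subset d) → T (X ⊆ᵇ Y) → X ⊆ Y
⊆ᵇ⇒⊆ (true  ∷ X) (true ∷ Y) h = s⊆s (⊆ᵇ⇒⊆ X Y h)
⊆ᵇ⇒⊆ (false ∷ X) (y    ∷ Y) h = out⊆ (⊆ᵇ⇒⊆ X Y (proj₂ (T-∧⁻ {not false ∨ y} h)))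

⊆⇒⊆ᵇ : ∀ (X Y : Subset d) → X ⊆ Y → T (X ⊆ᵇ Y)
⊆⇒⊆ᵇ []          []          _ = tt
⊆⇒⊆ᵇ (true  ∷ X) (true  ∷ Y) h = ⊆⇒⊆ᵇ X Y (drop-∷-⊆ h)
⊆⇒⊆ᵇ (true  ∷ X) (false ∷ Y) h with h here
... | ()
⊆⇒⊆ᵇ (false ∷ X) (true  ∷ Y) h = ⊆⇒⊆ᵇ X Y (drop-∷-⊆ h)
⊆⇒⊆ᵇ (false ∷ X) (false ∷ Y) h = ⊆⇒⊆ᵇ X Y (drop-∷-⊆ h)

==ˢ⇒≡ : ∀ (X Y : Subset d) → T (X ==ˢ Y) → X ≡ Y
==ˢ⇒≡ X Y h = let (X⊆Y , Y⊆X) = T-∧⁻ {X ⊆ᵇ Y} h in ⊆-antisym (⊆ᵇ⇒⊆ X Y X⊆Y) (⊆ᵇ⇒⊆ Y X Y⊆X)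

≡⇒==ˢ : ∀ (X Y : Subset d) → X ≡ Y → T (X ==ˢ Y)
≡⇒==ˢ X .X refl = T-∧⁺ (⊆⇒⊆ᵇ X X ⊆-refl) (⊆⇒⊆ᵇ X X ⊆-refl)

module _ {A : Set} where

  ∈-filterᵇ⁻ : ∀ (p : A → Bool) xs {x} → x ∈ˡ filterᵇ p xs → x ∈ˡ xs × T (p x)
  ∈-filterᵇ⁻ p (y ∷ xs) h with p y in eq
  ∈-filterᵇ⁻ p (y ∷ xs) (here refl) | true = here refl , ≡true⇒T eq
  ∈-filterᵇ⁻ p (y ∷ xs) (there h)   | true = let (m , px) = ∈-filterᵇ⁻ p xs h in there m , px
  ∈-filterᵇ⁻ p (y ∷ xs) h           | false = let (m , px) = ∈-filterᵇ⁻ p xs h in there m , px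

  ∈-filterᵇ⁺ : ∀ (p : A → Bool) xs {x} → x ∈ˡ xs → T (p x) → x ∈ˡ filterᵇ p xs
  ∈-filterᵇ⁺ p (y ∷ xs) m px with p y in eq
  ∈-filterᵇ⁺ p (y ∷ xs) (here refl) px | true  = here refl
  ∈-filterᵇ⁺ p (y ∷ xs) (there m)   px | true  = there (∈-filterᵇ⁺ p xs m px)
  ∈-filterᵇ⁺ p (y ∷ xs) (here refl) px | false = ⊥-elim (subst T eq px)
  ∈-filterᵇ⁺ p (y ∷ xs) (there m)   px | false = ∈-filterᵇ⁺ p xs m px

  anyᵇ⁻ : ∀ (p : A → Bool) xs → T (anyᵇ p xs) → ∃ λ x → x ∈ˡ xs × T (p x)
  anyᵇ⁻ p (x ∷ xs) h with T-∨⁻ {p x} h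
  ... | inj₁ px = x , here refl , px
  ... | inj₂ h′ = let (y , m , py) = anyᵇ⁻ p xs h′ in y , there m , py

  anyᵇ⁺ : ∀ (p : A → Bool) xs {x} → x ∈ˡ xs → T (p x) → T (anyᵇ p xs)
  anyᵇ⁺ p (y ∷ xs) (here refl) px = T-∨⁺ (inj₁ px)
  anyᵇ⁺ p (y ∷ xs) (there m)   px = T-∨⁺ {p y} (inj₂ (anyᵇ⁺ p xs m px))

  allᵇ⁻ : ∀ (p : A → Bool) xs → T (allᵇ p xs) → ∀ {x} → x ∈ˡ xs → T (p x)
  allᵇ⁻ p (y ∷ xs) h (here refl) = proj₁ (T-∧⁻ {p y} h)
  allᵇ⁻ p (y ∷ xs) h (there m)   = allᵇ⁻ p xs (proj₂ (T-∧⁻ {p y} h)) m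

  allᵇ⁺ : ∀ (p : A → Bool) xs → (∀ {x} → x ∈ˡ xs → T (p x)) → T (allᵇ p xs)
  allᵇ⁺ p []       h = tt
  allᵇ⁺ p (y ∷ xs) h = T-∧⁺ (h (here refl)) (allᵇ⁺ p xs (h ∘ there))

∈-allSubsets : ∀ {d} (X : Subset d) → X ∈ˡ allSubsets d
∈-allSubsets []                = here refl
∈-allSubsets {suc d} (true  ∷ X) = ∈-++⁺ˡ (∈-map⁺ (true ∷_) (∈-allSubsets X))
∈-allSubsets {suc d} (false ∷ X) = ∈-++⁺ʳ (map (true ∷_) (allSubsets d)) (∈-map⁺ (false ∷_) (∈-allSubsets X))

∈-⋃⁻ : ∀ (Ss : List (Subset d)) {x} → x ∈ ⋃ Ss → ∃ λ S → S ∈ˡ Ss × x ∈ S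
∈-⋃⁻ []       h = ⊥-elim (∉⊥ h)
∈-⋃⁻ (S ∷ Ss) h with x∈p∪q⁻ S (⋃ Ss) h
... | inj₁ x∈S = S , here refl , x∈S
... | inj₂ x∈⋃ = let (S′ , m , x∈S′) = ∈-⋃⁻ Ss x∈⋃ in S′ , there m , x∈S′

∈-⋃⁺ : ∀ (Ss : List (Subset d)) {x S} → S ∈ˡ Ss → x ∈ S → x ∈ ⋃ Ss
∈-⋃⁺ (S ∷ Ss) (here refl) h = x∈p∪q⁺ (inj₁ h)
∈-⋃⁺ (S ∷ Ss) (there m)   h = x∈p∪q⁺ (inj₂ (∈-⋃⁺ Ss m h))

≤-maxList : ∀ {x} xs → x ∈ˡ xs → x ≤ maxList xs
≤-maxList (y ∷ xs) (here refl) = m≤m⊔n y (maxList xs)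
≤-maxList (y ∷ xs) (there m)   = ≤-trans (≤-maxList xs m) (m≤n⊔m y (maxList xs))

maxList-least : ∀ {b} xs → (∀ {x} → x ∈ˡ xs → x ≤ b) → maxList xs ≤ b
maxList-least []       h = z≤n
maxList-least (y ∷ xs) h = ⊔-lub (h (here refl)) (maxList-least xs (h ∘ there))

maxList-attained : ∀ xs → maxList xs ≡ 0 ⊎ maxList xs ∈ˡ xs
maxList-attained []       = inj₁ refl
maxList-attained (y ∷ xs) with ⊔-sel y (maxList xs)
... | inj₁ e = inj₂ (here e)
... | inj₂ e with maxList-attained xs
...   | inj₁ z = inj₁ (trans e z)
...   | inj₂ m = inj₂ (there (subst (_∈ˡ xs) (sym e) m))

maxList-const : ∀ {v y} xs → y ∈ˡ xs → (∀ {x} → x ∈ˡ xs → x ≡ v) → maxList xs ≡ v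
maxList-const xs m h =
  ≤-antisym (maxList-least xs (≤-reflexive ∘ h)) (subst (_≤ maxList xs) (h m) (≤-maxList xs m))

module _ {A : Set} where

  ∑ : List A → (A → ℕ) → ℕ
  ∑ xs f = sum (map f xs)

  ∑-cong : ∀ xs {f g : A → ℕ} → (∀ x → f x ≡ g x) → ∑ xs f ≡ ∑ xs g
  ∑-cong []       _ = refl
  ∑-cong (x ∷ xs) h = cong₂ _+_ (h x) (∑-cong xs h)

  ∑-mono : ∀ xs {f g : A → ℕ} → (∀ x → f x ≤ g x) → ∑ xs f ≤ ∑ xs g
  ∑-mono []       _ = z≤n
  ∑-mono (x ∷ xs) h = +-mono-≤ (h x) (∑-mono xs h)

  ∑-zero : ∀ xs {f : A → ℕ} → (∀ x → f x ≡ 0) → ∑ xs f ≡ 0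
  ∑-zero []       _ = refl
  ∑-zero (x ∷ xs) h rewrite h x = ∑-zero xs h

  ∑-+ : ∀ xs (f g : A → ℕ) → ∑ xs (λ x → f x + g x) ≡ ∑ xs f + ∑ xs g
  ∑-+ []       f g = refl
  ∑-+ (x ∷ xs) f g rewrite ∑-+ xs f g = interchange (f x) (g x) (∑ xs f) (∑ xs g)

  ∑-*ˡ : ∀ xs c (f : A → ℕ) → ∑ xs (λ x → c * f x) ≡ c * ∑ xs f
  ∑-*ˡ []       c f = sym (*-zeroʳ c)
  ∑-*ˡ (x ∷ xs) c f rewrite ∑-*ˡ xs c f = sym (*-distribˡ-+ c (f x) (∑ xs f))

  ∑-++ : ∀ xs ys (f : A → ℕ) → ∑ (xs ++ ys) f ≡ ∑ xs f + ∑ ys f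
  ∑-++ xs ys f = trans (cong sum (map-++ f xs ys)) (sum-++ (map f xs) (map f ys))

  ∑-const : ∀ xs c → ∑ xs (λ _ → c) ≡ length xs * c
  ∑-const []       c = refl
  ∑-const (x ∷ xs) c = cong (c +_) (∑-const xs c)

∑-map : ∀ {A B : Set} xs (f : A → B) (g : B → ℕ) → ∑ (map f xs) g ≡ ∑ xs (g ∘ f)
∑-map []       f g = refl
∑-map (x ∷ xs) f g = cong (g (f x) +_) (∑-map xs f g)

∑-swap : ∀ {A B : Set} xs ys (h : A → B → ℕ) →
  ∑ xs (λ x → ∑ ys (h x)) ≡ ∑ ys (λ y → ∑ xs (λ x → h x y))
∑-swap []       ys h = sym (∑-zero ys (λ _ → refl))
∑-swap (x ∷ xs) ys h rewrite ∑-swap xs ys h = sym (∑-+ ys (h x) (λ y → ∑ xs (λ x′ → h x′ y)))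

ind : Bool → ℕ → ℕ
ind b k = if b then k else 0

ind-true : ∀ {b} k → T b → ind b k ≡ k
ind-true {true} k _ = refl

ind-false : ∀ {b} k → ¬ T b → ind b k ≡ 0
ind-false {false} k _ = refl
ind-false {true}  k h = ⊥-elim (h _)

ind-∧ : ∀ a b k → ind a (ind b k) ≡ ind (a ∧ b) k
ind-∧ true  b k = refl
ind-∧ false b k = refl

ind-* : ∀ b k → ind b k ≡ k * ind b 1
ind-* true  k = sym (*-identityʳ k)
ind-* false k = sym (*-zeroʳ k)

ind-1-≤ : ∀ {a b c} → (T a → T b × T c) → ind a 1 ≤ ind b (ind c 1)
ind-1-≤ {false}               _ = z≤n
ind-1-≤ {true} {true} {true}  _ = ≤-refl
ind-1-≤ {true} {false}        h = ⊥-elim (proj₁ (h _))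
ind-1-≤ {true} {true} {false} h = ⊥-elim (proj₂ (h _))

ind-1-≡ : ∀ {a b c} → (T a → T b × T c) → (T b → T c → T a) → ind a 1 ≡ ind b (ind c 1)
ind-1-≡ {true}  {true}  {true}  _ _ = refl
ind-1-≡ {true}  {false}         h _ = ⊥-elim (proj₁ (h _))
ind-1-≡ {true}  {true}  {false} h _ = ⊥-elim (proj₂ (h _))
ind-1-≡ {false} {true}  {true}  _ k = ⊥-elim (k _ _)
ind-1-≡ {false} {false}         _ _ = refl
ind-1-≡ {false} {true}  {false} _ _ = refl

∑-filterᵇ : ∀ {A : Set} (p : A → Bool) xs (g : A → ℕ) →
  ∑ (filterᵇ p xs) g ≡ ∑ xs (λ x → ind (p x) (g x))
∑-filterᵇ p []       g = refl
∑-filterᵇ p (x ∷ xs) g with p x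
... | true  = cong (g x +_) (∑-filterᵇ p xs g)
... | false = ∑-filterᵇ p xs g

∑-allSubsets-suc : ∀ {d} (f : Subset (suc d) → ℕ) →
  ∑ (allSubsets (suc d)) f ≡ ∑ (allSubsets d) (f ∘ (true ∷_)) + ∑ (allSubsets d) (f ∘ (false ∷_))
∑-allSubsets-suc {d} f =
  trans (∑-++ (map (true ∷_) (allSubsets d)) _ f)
        (cong₂ _+_ (∑-map (allSubsets d) (true ∷_) f) (∑-map (allSubsets d) (false ∷_) f))

∑-allSubsets-single : ∀ {d} (e : Subset d → Bool) Z → (∀ Y → T (e Y) → Y ≡ Z) → T (e Z) →
  (h : Subset d → ℕ) → ∑ (allSubsets d) (λ Y → ind (e Y) (h Y)) ≡ h Z
∑-allSubsets-single {zero}  e [] _ eZ h = trans (+-identityʳ _) (ind-true (h []) eZ)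
∑-allSubsets-single {suc d} e (b ∷ Z) only eZ h =
  trans (∑-allSubsets-suc (λ Y → ind (e Y) (h Y))) (halves b only eZ)
  where
  rest : ∀ b → (∀ Y → T (e (b ∷ Y)) → Y ≡ Z) → T (e (b ∷ Z)) →
    ∑ (allSubsets d) (λ Y → ind (e (b ∷ Y)) (h (b ∷ Y))) ≡ h (b ∷ Z)
  rest b only′ eZ′ = ∑-allSubsets-single (e ∘ (b ∷_)) Z only′ eZ′ (h ∘ (b ∷_))
  none : ∀ b → (∀ Y → ¬ T (e (b ∷ Y))) → ∑ (allSubsets d) (λ Y → ind (e (b ∷ Y)) (h (b ∷ Y))) ≡ 0
  none b absent = ∑-zero (allSubsets d) (λ Y → ind-false _ (absent Y))
  halves : ∀ b → (∀ Y → T (e Y) → Y ≡ b ∷ Z) → T (e (b ∷ Z)) →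
    ∑ (allSubsets d) (λ Y → ind (e (true ∷ Y)) (h (true ∷ Y))) +
    ∑ (allSubsets d) (λ Y → ind (e (false ∷ Y)) (h (false ∷ Y))) ≡ h (b ∷ Z)
  halves true only′ eZ′ =
    trans (cong₂ _+_ (rest true (λ Y → ∷-injectiveʳ ∘ only′ _) eZ′)
                     (none false (λ Y eY → case ∷-injectiveˡ (only′ _ eY) of λ ())))
          (+-identityʳ _)
  halves false only′ eZ′ =
    cong₂ _+_ (none true (λ Y eY → case ∷-injectiveˡ (only′ _ eY) of λ ()))
              (rest false (λ Y → ∷-injectiveʳ ∘ only′ _) eZ′)

∑-allSubsets-reindex : ∀ {d} (P P′ : Subset d → Bool) (ψ : Subset d → Subset d) (g g′ : Subset d → ℕ) →
  (∀ Y → T (P Y) → T (P′ (ψ Y))) →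
  (∀ X → T (P′ X) → Σ (Subset d) λ Y → T (P Y) × ψ Y ≡ X) →
  (∀ Y₁ Y₂ → T (P Y₁) → T (P Y₂) → ψ Y₁ ≡ ψ Y₂ → Y₁ ≡ Y₂) →
  (∀ Y → T (P Y) → g′ (ψ Y) ≡ g Y) →
  ∑ (allSubsets d) (λ X → ind (P′ X) (g′ X)) ≡ ∑ (allSubsets d) (λ Y → ind (P Y) (g Y))
∑-allSubsets-reindex {d} P P′ ψ g g′ into onto inj gψ = begin
    ∑ all (λ X → ind (P′ X) (g′ X))
  ≡⟨ ∑-cong all fibre ⟨
    ∑ all (λ X → ∑ all (λ Y → ind (hit X Y) (g′ X)))
  ≡⟨ ∑-swap all all _ ⟩
    ∑ all (λ Y → ∑ all (λ X → ind (hit X Y) (g′ X)))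
  ≡⟨ ∑-cong all image ⟩
    ∑ all (λ Y → ind (P Y) (g Y)) ∎
  where
  open ≡-Reasoning
  all = allSubsets d

  hit : Subset d → Subset d → Bool
  hit X Y = P Y ∧ (X ==ˢ ψ Y)

  hit⇒≡ : ∀ {X Y} → T (hit X Y) → X ≡ ψ Y
  hit⇒≡ {X} {Y} h = ==ˢ⇒≡ X (ψ Y) (proj₂ (T-∧⁻ {P Y} h))

  image : ∀ Y → ∑ all (λ X → ind (hit X Y) (g′ X)) ≡ ind (P Y) (g Y)
  image Y with P Y in eq
  ... | true  = trans (∑-allSubsets-single (_==ˢ ψ Y) (ψ Y) (λ X → ==ˢ⇒≡ X (ψ Y)) (≡⇒==ˢ (ψ Y) (ψ Y) refl) g′)
                      (gψ Y (≡true⇒T eq))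
  ... | false = ∑-zero all (λ _ → refl)

  fibre : ∀ X → ∑ all (λ Y → ind (hit X Y) (g′ X)) ≡ ind (P′ X) (g′ X)
  fibre X with P′ X in eq
  ... | true  = let (Y₀ , PY₀ , ψY₀≡X) = onto X (≡true⇒T eq) in
    ∑-allSubsets-single (hit X) Y₀
      (λ Y h → inj Y Y₀ (proj₁ (T-∧⁻ {P Y} h)) PY₀ (trans (sym (hit⇒≡ h)) (sym ψY₀≡X)))
      (T-∧⁺ PY₀ (≡⇒==ˢ X (ψ Y₀) (sym ψY₀≡X))) (λ _ → g′ X)
  ... | false = ∑-zero all λ Y → ind-false (g′ X) λ h →
    subst T eq (subst (T ∘ P′) (sym (hit⇒≡ h)) (into Y (proj₁ (T-∧⁻ {P Y} h))))

⁅⁆⊆ : ∀ {x : Fin d} {S} → x ∈ S → ⁅ x ⁆ ⊆ S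
⁅⁆⊆ {x = x} {S} x∈S y∈⁅x⁆ = subst (_∈ S) (sym (x∈⁅y⁆⇒x≡y x y∈⁅x⁆)) x∈S

∪⁅⁆-least : ∀ {X S : Subset d} {x} → X ⊆ S → x ∈ S → X ∪ ⁅ x ⁆ ⊆ S
∪⁅⁆-least X⊆S x∈S h with x∈p∪q⁻ _ _ h
... | inj₁ y∈X   = X⊆S y∈X
... | inj₂ y∈⁅x⁆ = ⁅⁆⊆ x∈S y∈⁅x⁆

∪⁅⁆-mono : ∀ {X Y : Subset d} {x} → X ⊆ Y → X ∪ ⁅ x ⁆ ⊆ Y ∪ ⁅ x ⁆
∪⁅⁆-mono {x = x} X⊆Y = ∪⁅⁆-least (⊆-trans X⊆Y (p⊆p∪q _)) (x∈p∪q⁺ (inj₂ (x∈⁅x⁆ x)))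

∪⁅⁆-absorb : ∀ {X : Subset d} {x} → x ∈ X → X ∪ ⁅ x ⁆ ≡ X
∪⁅⁆-absorb x∈X = ⊆-antisym (∪⁅⁆-least ⊆-refl x∈X) (p⊆p∪q _)

p⊆q⇒p∩q≡p : ∀ {X H : Subset d} → X ⊆ H → X ∩ H ≡ X
p⊆q⇒p∩q≡p X⊆H = ⊆-antisym (p∩q⊆p _ _) (λ h → x∈p∩q⁺ (h , X⊆H h))

∣p∪⁅x⁆∣≡1+∣p∣ : ∀ (X : Subset d) x → x ∉ X → ∣ X ∪ ⁅ x ⁆ ∣ ≡ suc ∣ X ∣
∣p∪⁅x⁆∣≡1+∣p∣ (false ∷ X) fzero    _ rewrite ∪-identityʳ X = refl
∣p∪⁅x⁆∣≡1+∣p∣ (true  ∷ X) fzero    h = ⊥-elim (h here)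
∣p∪⁅x⁆∣≡1+∣p∣ (true  ∷ X) (fsuc x) h = cong suc (∣p∪⁅x⁆∣≡1+∣p∣ X x (λ m → h (there m)))
∣p∪⁅x⁆∣≡1+∣p∣ (false ∷ X) (fsuc x) h = ∣p∪⁅x⁆∣≡1+∣p∣ X x (λ m → h (there m))

∣p∪⁅x⁆∣≤1+∣p∣ : ∀ (X : Subset d) x → ∣ X ∪ ⁅ x ⁆ ∣ ≤ suc ∣ X ∣
∣p∪⁅x⁆∣≤1+∣p∣ X x with x ∈? X
... | no  x∉X = ≤-reflexive (∣p∪⁅x⁆∣≡1+∣p∣ X x x∉X)
... | yes x∈X = ≤-trans (≤-reflexive (cong ∣_∣ (∪⁅⁆-absorb x∈X))) (n≤1+n _)

p⊆q⇒∣q∣≤∣p∣⇒p≡q : ∀ (Y X : Subset d) → Y ⊆ X → ∣ X ∣ ≤ ∣ Y ∣ → Y ≡ X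
p⊆q⇒∣q∣≤∣p∣⇒p≡q []          []          _ _ = refl
p⊆q⇒∣q∣≤∣p∣⇒p≡q (true  ∷ Y) (true  ∷ X) s c =
  cong (true ∷_) (p⊆q⇒∣q∣≤∣p∣⇒p≡q Y X (drop-∷-⊆ s) (≤-pred c))
p⊆q⇒∣q∣≤∣p∣⇒p≡q (false ∷ Y) (false ∷ X) s c =
  cong (false ∷_) (p⊆q⇒∣q∣≤∣p∣⇒p≡q Y X (drop-∷-⊆ s) c)
p⊆q⇒∣q∣≤∣p∣⇒p≡q (true  ∷ Y) (false ∷ X) s c with s here
... | ()
p⊆q⇒∣q∣≤∣p∣⇒p≡q (false ∷ Y) (true  ∷ X) s c =
  ⊥-elim (<-irrefl refl (≤-trans c (p⊆q⇒∣p∣≤∣q∣ (drop-∷-⊆ s))))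

p⊆q∧p≢q⇒∣p∣<∣q∣ : ∀ {Y S : Subset d} → Y ⊆ S → Y ≢ S → ∣ Y ∣ < ∣ S ∣
p⊆q∧p≢q⇒∣p∣<∣q∣ {Y = Y} {S} Y⊆S Y≢S with ≤-<-connex ∣ S ∣ ∣ Y ∣
... | inj₁ ∣S∣≤∣Y∣ = ⊥-elim (Y≢S (p⊆q⇒∣q∣≤∣p∣⇒p≡q Y S Y⊆S ∣S∣≤∣Y∣))
... | inj₂ ∣Y∣<∣S∣ = ∣Y∣<∣S∣

subset-of-size : ∀ (S : Subset d) k → k ≤ ∣ S ∣ → Σ (Subset d) λ T → T ⊆ S × ∣ T ∣ ≡ k
subset-of-size {d} S zero _ = ⊥ , ⊥⊆ , ∣⊥∣≡0 d
subset-of-size (true ∷ S) (suc k) (s≤s k≤∣S∣) =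
  let (T , T⊆S , ∣T∣≡k) = subset-of-size S k k≤∣S∣ in true ∷ T , s⊆s T⊆S , cong suc ∣T∣≡k
subset-of-size (false ∷ S) (suc k) k<∣S∣ =
  let (T , T⊆S , ∣T∣≡k) = subset-of-size S (suc k) k<∣S∣ in false ∷ T , out⊆ T⊆S , ∣T∣≡k

subset-of-size-∋ : ∀ (S : Subset d) {x} k → x ∈ S → k < ∣ S ∣ →
  Σ (Subset d) λ T → T ⊆ S × x ∈ T × ∣ T ∣ ≡ suc k
subset-of-size-∋ S {x} zero x∈S _ = ⁅ x ⁆ , ⁅⁆⊆ x∈S , x∈⁅x⁆ x , ∣⁅x⁆∣≡1 x
subset-of-size-∋ (true ∷ S) {fzero} (suc k) here (s≤s k<∣S∣) =
  let (T , T⊆S , ∣T∣≡k) = subset-of-size S (suc k) k<∣S∣ in true ∷ T , s⊆s T⊆S , here , cong suc ∣T∣≡k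
subset-of-size-∋ (true ∷ S) {fsuc x} (suc k) (there x∈S) (s≤s k<∣S∣) =
  let (T , T⊆S , x∈T , ∣T∣≡k) = subset-of-size-∋ S k x∈S k<∣S∣ in
  true ∷ T , s⊆s T⊆S , there x∈T , cong suc ∣T∣≡k
subset-of-size-∋ (false ∷ S) {fsuc x} (suc k) (there x∈S) k<∣S∣ =
  let (T , T⊆S , x∈T , ∣T∣≡k) = subset-of-size-∋ S (suc k) x∈S k<∣S∣ in
  false ∷ T , out⊆ T⊆S , there x∈T , ∣T∣≡k

-- Rank, span and closure

module RankProperties {d : ℕ} (M : Matroid d) where

  indep⇒∣∣≤rk : ∀ {X Y} → Indep M Y → Y ⊆ X → ∣ Y ∣ ≤ rk M X
  indep⇒∣∣≤rk {X} {Y} iY Y⊆X = ≤-maxList _ (∈-map⁺ ∣_∣ (∈-filterᵇ⁺ _ (allSubsets d) (∈-allSubsets Y)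
                                                         (T-∧⁺ (⊆⇒⊆ᵇ Y X Y⊆X) iY)))

  rk-witness : ∀ X → Σ (Subset d) λ Y → Indep M Y × Y ⊆ X × ∣ Y ∣ ≡ rk M X
  rk-witness X with maxList-attained (map ∣_∣ (filterᵇ (λ Y → (Y ⊆ᵇ X) ∧ indep M Y) (allSubsets d)))
  ... | inj₁ rk≡0 = ⊥ , indep-∅ M , ⊥⊆ , trans (∣⊥∣≡0 d) (sym rk≡0)
  ... | inj₂ m with ∈-map⁻ ∣_∣ m
  ... | Y , mY , rk≡∣Y∣ =
    let (Y⊆X , iY) = T-∧⁻ {Y ⊆ᵇ X} (proj₂ (∈-filterᵇ⁻ _ (allSubsets d) mY)) in
    Y , iY , ⊆ᵇ⇒⊆ Y X Y⊆X , sym rk≡∣Y∣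

  rk-mono : ∀ {X X′} → X ⊆ X′ → rk M X ≤ rk M X′
  rk-mono {X} X⊆X′ = let (Y , iY , Y⊆X , ∣Y∣≡) = rk-witness X in
    subst (_≤ _) ∣Y∣≡ (indep⇒∣∣≤rk iY (⊆-trans Y⊆X X⊆X′))

  rk≤∣∣ : ∀ X → rk M X ≤ ∣ X ∣
  rk≤∣∣ X = let (Y , _ , Y⊆X , ∣Y∣≡) = rk-witness X in subst (_≤ _) ∣Y∣≡ (p⊆q⇒∣p∣≤∣q∣ Y⊆X)

  rk≤rank : ∀ X → rk M X ≤ rank M
  rk≤rank X = rk-mono ⊆⊤

  indep⇒rk≡∣∣ : ∀ {X} → Indep M X → rk M X ≡ ∣ X ∣
  indep⇒rk≡∣∣ {X} iX = ≤-antisym (rk≤∣∣ X) (indep⇒∣∣≤rk iX ⊆-refl)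

  dep⇒rk<∣∣ : ∀ {X} → ¬ Indep M X → rk M X < ∣ X ∣
  dep⇒rk<∣∣ {X} ¬iX with rk-witness X
  ... | Y , iY , Y⊆X , ∣Y∣≡ with ≤-<-connex ∣ X ∣ ∣ Y ∣
  ... | inj₁ ∣X∣≤∣Y∣ = ⊥-elim (¬iX (subst (Indep M) (p⊆q⇒∣q∣≤∣p∣⇒p≡q Y X Y⊆X ∣X∣≤∣Y∣) iY))
  ... | inj₂ ∣Y∣<∣X∣ = subst (_< _) ∣Y∣≡ ∣Y∣<∣X∣

  full-rank-maximal : ∀ {I S z} → I ⊆ S → ∣ I ∣ ≡ rk M S → z ∈ S → z ∉ I → ¬ Indep M (I ∪ ⁅ z ⁆)
  full-rank-maximal {I} {S} {z} I⊆S ∣I∣≡ z∈S z∉I iIz = n≮n ∣ I ∣ (begin-strict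
    ∣ I ∣             <⟨ n<1+n _ ⟩
    suc ∣ I ∣         ≡⟨ ∣p∪⁅x⁆∣≡1+∣p∣ I z z∉I ⟨
    ∣ I ∪ ⁅ z ⁆ ∣     ≤⟨ indep⇒∣∣≤rk iIz (∪⁅⁆-least I⊆S z∈S) ⟩
    rk M S            ≡⟨ ∣I∣≡ ⟨
    ∣ I ∣             ∎)
    where open ≤-Reasoning

  rk-jump⇒indep : ∀ {I S} x → Indep M I → I ⊆ S → ∣ I ∣ ≡ rk M S → rk M S < rk M (S ∪ ⁅ x ⁆) →
                  Indep M (I ∪ ⁅ x ⁆) × x ∉ S
  rk-jump⇒indep {I} {S} x iI I⊆S ∣I∣≡ jump with rk-witness (S ∪ ⁅ x ⁆)
  ... | J , iJ , J⊆ , ∣J∣≡ with augment M I J iI iJ (subst₂ _<_ (sym ∣I∣≡) (sym ∣J∣≡) jump)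
  ... | z , z∈J , z∉I , iIz with z ∈? S
  ... | yes z∈S = ⊥-elim (full-rank-maximal I⊆S ∣I∣≡ z∈S z∉I iIz)
  ... | no  z∉S with x∈p∪q⁻ S ⁅ x ⁆ (J⊆ z∈J)
  ...   | inj₁ z∈S   = ⊥-elim (z∉S z∈S)
  ...   | inj₂ z∈⁅x⁆ rewrite x∈⁅y⁆⇒x≡y x z∈⁅x⁆ = iIz , z∉S

  private
    extend-within : ∀ k {I S} → Indep M I → I ⊆ S → rk M S ≤ k + ∣ I ∣ →
                    Σ (Subset d) λ J → I ⊆ J × J ⊆ S × Indep M J × ∣ J ∣ ≡ rk M S
    extend-within k {I} {S} iI I⊆S bound with ≤-<-connex (rk M S) ∣ I ∣
    ... | inj₁ rk≤∣I∣ = I , ⊆-refl , I⊆S , iI , ≤-antisym (indep⇒∣∣≤rk iI I⊆S) rk≤∣I∣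
    extend-within zero    iI I⊆S bound | inj₂ ∣I∣<rk = ⊥-elim (<⇒≱ ∣I∣<rk bound)
    extend-within (suc k) {I} {S} iI I⊆S bound | inj₂ ∣I∣<rk with rk-witness S
    ... | W , iW , W⊆S , ∣W∣≡ with augment M I W iI iW (subst (_ <_) (sym ∣W∣≡) ∣I∣<rk)
    ... | z , z∈W , z∉I , iIz
      with extend-within k iIz (∪⁅⁆-least I⊆S (W⊆S z∈W))
             (subst (rk M S ≤_) (trans (sym (+-suc k ∣ I ∣)) (cong (k +_) (sym (∣p∪⁅x⁆∣≡1+∣p∣ I z z∉I))))
                    bound)
    ... | J , Iz⊆J , J⊆S , iJ , ∣J∣≡ = J , ⊆-trans (p⊆p∪q _) Iz⊆J , J⊆S , iJ , ∣J∣≡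

  indep-extend : ∀ {I S} → Indep M I → I ⊆ S →
                 Σ (Subset d) λ J → I ⊆ J × J ⊆ S × Indep M J × ∣ J ∣ ≡ rk M S
  indep-extend {S = S} iI I⊆S = extend-within (rk M S) iI I⊆S (m≤m+n _ _)

  Spans : Subset d → Fin d → Set
  Spans X x = rk M (X ∪ ⁅ x ⁆) ≡ rk M X

  spans-∈ : ∀ {X x} → x ∈ X → Spans X x
  spans-∈ x∈X = cong (rk M) (∪⁅⁆-absorb x∈X)

  spans-mono : ∀ {A B} x → A ⊆ B → Spans A x → Spans B x
  spans-mono {A} {B} x A⊆B spansA with ≤-<-connex (rk M (B ∪ ⁅ x ⁆)) (rk M B)
  ... | inj₁ ≤rkB = ≤-antisym ≤rkB (rk-mono (p⊆p∪q _))
  ... | inj₂ jump with rk-witness A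
  ... | I , iI , I⊆A , ∣I∣≡ with indep-extend iI (⊆-trans I⊆A A⊆B)
  ... | J , I⊆J , J⊆B , iJ , ∣J∣≡ with rk-jump⇒indep x iJ J⊆B ∣J∣≡ jump
  ... | iJx , x∉B = ⊥-elim (full-rank-maximal (⊆-trans I⊆A (p⊆p∪q _)) (trans ∣I∣≡ (sym spansA))
                             (x∈p∪q⁺ (inj₂ (x∈⁅x⁆ x))) (λ x∈I → x∉B (A⊆B (I⊆A x∈I)))
                             (hered M _ _ (∪⁅⁆-mono I⊆J) iJx))

  rk-∪-spanned : ∀ X Z → (∀ {z} → z ∈ Z → Spans X z) → rk M (X ∪ Z) ≤ rk M X
  rk-∪-spanned X Z spanned with rk-witness X | rk-witness (X ∪ Z)
  ... | I , iI , I⊆X , ∣I∣≡ | J , iJ , J⊆ , ∣J∣≡ with ≤-<-connex ∣ J ∣ ∣ I ∣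
  ... | inj₁ ∣J∣≤∣I∣ = subst₂ _≤_ ∣J∣≡ ∣I∣≡ ∣J∣≤∣I∣
  ... | inj₂ ∣I∣<∣J∣ with augment M I J iI iJ ∣I∣<∣J∣
  ... | z , z∈J , z∉I , iIz =
    ⊥-elim (full-rank-maximal (⊆-trans I⊆X (p⊆p∪q _)) (trans ∣I∣≡ (sym spans-z))
                              (x∈p∪q⁺ (inj₂ (x∈⁅x⁆ z))) z∉I iIz)
    where
    spans-z : Spans X z
    spans-z = [ spans-∈ , spanned ]′ (x∈p∪q⁻ X Z (J⊆ z∈J))

  spans-trans : ∀ {X Y x} → (∀ {z} → z ∈ X → Spans Y z) → Spans X x → Spans Y x
  spans-trans {X} {Y} {x} spanned spansX = ≤-antisym rk[Y+x]≤ (rk-mono (p⊆p∪q _))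
    where
    open ≤-Reasoning
    rk[Y∪X]≡ : rk M (Y ∪ X) ≡ rk M Y
    rk[Y∪X]≡ = ≤-antisym (rk-∪-spanned Y X spanned) (rk-mono (p⊆p∪q X))
    rk[Y+x]≤ : rk M (Y ∪ ⁅ x ⁆) ≤ rk M Y
    rk[Y+x]≤ = begin
      rk M (Y ∪ ⁅ x ⁆)         ≤⟨ rk-mono (∪⁅⁆-mono (p⊆p∪q X)) ⟩
      rk M ((Y ∪ X) ∪ ⁅ x ⁆)   ≡⟨ spans-mono x (q⊆p∪q Y X) spansX ⟩
      rk M (Y ∪ X)             ≡⟨ rk[Y∪X]≡ ⟩
      rk M Y                   ∎

  rk-≡-mutually-spanned : ∀ {X₁ X₂} → (∀ {z} → z ∈ X₁ → Spans X₂ z) →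
                          (∀ {z} → z ∈ X₂ → Spans X₁ z) →
                          rk M X₁ ≡ rk M X₂
  rk-≡-mutually-spanned {X₁} {X₂} X₂-spans X₁-spans =
    ≤-antisym (≤-trans (rk-mono (q⊆p∪q X₂ X₁)) (rk-∪-spanned X₂ X₁ X₂-spans))
              (≤-trans (rk-mono (q⊆p∪q X₁ X₂)) (rk-∪-spanned X₁ X₂ X₁-spans))

  ∈-cl⁻ : ∀ E X {x} → x ∈ cl M E X → x ∈ E × Spans X x
  ∈-cl⁻ E X {x} h =
    let (x∈E , spans) = T-∧⁻ {lookup E x} (subst T (lookup∘tabulate _ x) (∈⇒lookup h)) in
    lookup⇒∈ x∈E , ≡ᵇ⇒≡ _ _ spans

  ∈-cl⁺ : ∀ E X {x} → x ∈ E → Spans X x → x ∈ cl M E X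
  ∈-cl⁺ E X {x} x∈E spans =
    lookup⇒∈ (subst T (sym (lookup∘tabulate _ x)) (T-∧⁺ (∈⇒lookup x∈E) (≡⇒≡ᵇ _ _ spans)))

-- Circuits and subspaces

module CircuitProperties {d : ℕ} (M : Matroid d) where

  open RankProperties M

  IsCircuit : Subset d → Subset d → Set
  IsCircuit E C = C ⊆ E × ¬ Indep M C × (∀ Y → Y ⊆ C → Y ≢ C → Indep M Y)

  isCircuit⇒IsCircuit : ∀ {E C} → T (isCircuit M E C) → IsCircuit E C
  isCircuit⇒IsCircuit {E} {C} h = ⊆ᵇ⇒⊆ C E C⊆E , T-not⁻ ¬iC , proper-indep
    where
    C⊆E = proj₁ (T-∧⁻ {C ⊆ᵇ E} h)
    ¬iC = proj₁ (T-∧⁻ {not (indep M C)} (proj₂ (T-∧⁻ {C ⊆ᵇ E} h)))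
    minimal = proj₂ (T-∧⁻ {not (indep M C)} (proj₂ (T-∧⁻ {C ⊆ᵇ E} h)))
    proper-indep : ∀ Y → Y ⊆ C → Y ≢ C → Indep M Y
    proper-indep Y Y⊆C Y≢C with T-∨⁻ (allᵇ⁻ _ (allSubsets d) minimal (∈-allSubsets Y))
    ... | inj₂ iY       = iY
    ... | inj₁ ¬proper = ⊥-elim (T-not⁻ ¬proper (T-∧⁺ (⊆⇒⊆ᵇ Y C Y⊆C) (T-not⁺ (Y≢C ∘ ==ˢ⇒≡ Y C))))

  IsCircuit⇒isCircuit : ∀ {E C} → IsCircuit E C → T (isCircuit M E C)
  IsCircuit⇒isCircuit {E} {C} (C⊆E , ¬iC , proper-indep) =
    T-∧⁺ (⊆⇒⊆ᵇ C E C⊆E) (T-∧⁺ (T-not⁺ ¬iC) (allᵇ⁺ _ (allSubsets d) (λ {Y} _ → minimal Y)))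
    where
    minimal : ∀ Y → T (not ((Y ⊆ᵇ C) ∧ not (Y ==ˢ C)) ∨ indep M Y)
    minimal Y with (Y ⊆ᵇ C) ∧ not (Y ==ˢ C) in eq
    ... | false = tt
    ... | true  = let (Y⊆C , Y≢C) = T-∧⁻ {Y ⊆ᵇ C} (≡true⇒T eq) in
      proper-indep Y (⊆ᵇ⇒⊆ Y C Y⊆C) (T-not⁻ Y≢C ∘ ≡⇒==ˢ Y C)

  IsSmallCircuit : Subset d → Subset d → Set
  IsSmallCircuit E C = IsCircuit E C × ∣ C ∣ ≤ rk M E

  ∈-smallCircuits⁻ : ∀ {E C} → C ∈ˡ smallCircuits M E → IsSmallCircuit E C
  ∈-smallCircuits⁻ {E} {C} m =
    let (circ , small) = T-∧⁻ {isCircuit M E C} (proj₂ (∈-filterᵇ⁻ _ (allSubsets d) m)) in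
    isCircuit⇒IsCircuit circ , ≤ᵇ⇒≤ _ _ small

  ∈-smallCircuits⁺ : ∀ {E C} → IsSmallCircuit E C → C ∈ˡ smallCircuits M E
  ∈-smallCircuits⁺ {E} {C} (circ , small) =
    ∈-filterᵇ⁺ _ (allSubsets d) (∈-allSubsets C) (T-∧⁺ (IsCircuit⇒isCircuit circ) (≤⇒≤ᵇ small))

  InClass : Subset d → Subset d → Subset d → Set
  InClass E F C = IsSmallCircuit E C × cl M E C ≡ F

  isSubspace : Subset d → Subset d → Bool
  isSubspace E F = anyᵇ (λ C → cl M E C ==ˢ F) (smallCircuits M E)

  isSubspace⁻ : ∀ {E F} → T (isSubspace E F) → Σ (Subset d) (InClass E F)
  isSubspace⁻ {E} {F} h = let (C , m , clC≡F) = anyᵇ⁻ _ (smallCircuits M E) h in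
    C , ∈-smallCircuits⁻ m , ==ˢ⇒≡ _ _ clC≡F

  isSubspace⁺ : ∀ {E F C} → InClass E F C → T (isSubspace E F)
  isSubspace⁺ {E} (small , clC≡F) = anyᵇ⁺ _ (smallCircuits M E) (∈-smallCircuits⁺ small) (≡⇒==ˢ _ _ clC≡F)

  ∈-classCircuits⁻ : ∀ {E F C} → C ∈ˡ classCircuits M E F → InClass E F C
  ∈-classCircuits⁻ {E} m = let (m′ , clC≡F) = ∈-filterᵇ⁻ _ (smallCircuits M E) m in
    ∈-smallCircuits⁻ m′ , ==ˢ⇒≡ _ _ clC≡F

  ∈-classCircuits⁺ : ∀ {E F C} → InClass E F C → C ∈ˡ classCircuits M E F
  ∈-classCircuits⁺ (small , clC≡F) = ∈-filterᵇ⁺ _ _ (∈-smallCircuits⁺ small) (≡⇒==ˢ _ _ clC≡F)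

  ∈-points⁻ : ∀ {E F x} → x ∈ points M E F → Σ (Subset d) λ C → InClass E F C × x ∈ C
  ∈-points⁻ h = let (C , m , x∈C) = ∈-⋃⁻ _ h in C , ∈-classCircuits⁻ m , x∈C

  ∈-points⁺ : ∀ {E F x C} → InClass E F C → x ∈ C → x ∈ points M E F
  ∈-points⁺ inClass x∈C = ∈-⋃⁺ _ (∈-classCircuits⁺ inClass) x∈C

  ⊆-cl : ∀ {E C} → C ⊆ E → C ⊆ cl M E C
  ⊆-cl {E} {C} C⊆E x∈C = ∈-cl⁺ E C (C⊆E x∈C) (spans-∈ x∈C)

  InClass-rk : ∀ {E F C₁ C₂} → InClass E F C₁ → InClass E F C₂ → rk M C₁ ≡ rk M C₂
  InClass-rk {E} {F} {C₁} {C₂} ((circ₁ , _) , cl₁) ((circ₂ , _) , cl₂) =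
    rk-≡-mutually-spanned (spanned-by C₂ (trans cl₁ (sym cl₂)) (proj₁ circ₁))
                          (spanned-by C₁ (trans cl₂ (sym cl₁)) (proj₁ circ₂))
    where
    spanned-by : ∀ C′ {C} → cl M E C ≡ cl M E C′ → C ⊆ E → ∀ {z} → z ∈ C → Spans C′ z
    spanned-by C′ cl≡ C⊆E z∈C = proj₂ (∈-cl⁻ E C′ (subst (_ ∈_) cl≡ (⊆-cl C⊆E z∈C)))

  subRank≡rk : ∀ {E F C} → InClass E F C → subRank M E F ≡ rk M C
  subRank≡rk inClass = maxList-const _ (∈-map⁺ (rk M) (∈-classCircuits⁺ inClass)) λ m →
    let (C′ , m′ , e) = ∈-map⁻ (rk M) m in trans e (InClass-rk (∈-classCircuits⁻ m′) inClass)

  subRank≤rank : ∀ E F → subRank M E F ≤ rank M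
  subRank≤rank E F = maxList-least (map (rk M) (classCircuits M E F)) λ m →
    let (C′ , _ , e) = ∈-map⁻ (rk M) {xs = classCircuits M E F} m in subst (_≤ _) (sym e) (rk≤rank C′)

  subRank≤subSize : ∀ {E F} → T (isSubspace E F) → subRank M E F ≤ subSize M E F
  subRank≤subSize {E} {F} h = let (C , inClass) = isSubspace⁻ h in begin
    subRank M E F   ≡⟨ subRank≡rk inClass ⟩
    rk M C          ≤⟨ rk≤∣∣ C ⟩
    ∣ C ∣           ≤⟨ p⊆q⇒∣p∣≤∣q∣ (∈-points⁺ inClass) ⟩
    subSize M E F   ∎
    where open ≤-Reasoning

  cl-restrict : ∀ {E C} → cl M E C ≡ cl M ⊤ C ∩ E
  cl-restrict {E} {C} = ⊆-antisym
    (λ h → let (x∈E , spans) = ∈-cl⁻ E C h in x∈p∩q⁺ (∈-cl⁺ ⊤ C ∈⊤ spans , x∈E))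
    (λ h → let (x∈cl , x∈E) = x∈p∩q⁻ _ _ h in ∈-cl⁺ E C x∈E (proj₂ (∈-cl⁻ ⊤ C x∈cl)))

  cl-∩-injective : ∀ {E C₁ C₂} → C₁ ⊆ E → C₂ ⊆ E →
                   cl M ⊤ C₁ ∩ E ≡ cl M ⊤ C₂ ∩ E → cl M ⊤ C₁ ≡ cl M ⊤ C₂
  cl-∩-injective {E} C₁⊆E C₂⊆E eq = ⊆-antisym (cl-⊆ C₁⊆E eq) (cl-⊆ C₂⊆E (sym eq))
    where
    cl-⊆ : ∀ {A B} → A ⊆ E → cl M ⊤ A ∩ E ≡ cl M ⊤ B ∩ E → cl M ⊤ A ⊆ cl M ⊤ B
    cl-⊆ {A} {B} A⊆E eq′ h = ∈-cl⁺ ⊤ B ∈⊤ (spans-trans B-spans-A (proj₂ (∈-cl⁻ ⊤ A h)))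
      where
      B-spans-A : ∀ {z} → z ∈ A → Spans B z
      B-spans-A z∈A = proj₂ (∈-cl⁻ ⊤ B (proj₁ (x∈p∩q⁻ _ _
        (subst (_ ∈_) eq′ (x∈p∩q⁺ (∈-cl⁺ ⊤ A ∈⊤ (spans-∈ z∈A) , A⊆E z∈A))))))

-- Orderings and prefix counts

∑-allFin-suc : ∀ (h : Fin (suc d) → ℕ) → ∑ (allFin (suc d)) h ≡ h fzero + ∑ (allFin d) (h ∘ fsuc)
∑-allFin-suc h = cong (h fzero +_)
  (trans (cong sum (map-tabulate fsuc h)) (sym (cong sum (map-tabulate (λ x → x) (h ∘ fsuc)))))

filterᵇ-unique : ∀ {A : Set} (p : A → Bool) xs → Unique xs → Unique (filterᵇ p xs)
filterᵇ-unique p []       []                = []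
filterᵇ-unique p (x ∷ xs) (x∉xs ∷ unique-xs) with p x
... | true  = all-filterᵇ xs x∉xs ∷ filterᵇ-unique p xs unique-xs
  where
  all-filterᵇ : ∀ {Q : _ → Set} ys → All Q ys → All Q (filterᵇ p ys)
  all-filterᵇ []       []       = []
  all-filterᵇ (y ∷ ys) (q ∷ qs) with p y
  ... | true  = q ∷ all-filterᵇ ys qs
  ... | false = all-filterᵇ ys qs
... | false = filterᵇ-unique p xs unique-xs

∣p∩⁅x⁆∪q∣ : ∀ (P U : Subset d) x → x ∉ U → ∣ P ∩ (⁅ x ⁆ ∪ U) ∣ ≡ ind (lookup P x) 1 + ∣ P ∩ U ∣
∣p∩⁅x⁆∪q∣ (b ∷ P) (true ∷ U) fzero x∉U = ⊥-elim (x∉U here)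
∣p∩⁅x⁆∪q∣ (b ∷ P) (false ∷ U) fzero _ rewrite ∪-identityˡ U with b
... | true  = refl
... | false = refl
∣p∩⁅x⁆∪q∣ (b ∷ P) (u ∷ U) (fsuc x) x∉U with b ∧ u
... | true  = trans (cong suc (∣p∩⁅x⁆∪q∣ P U x (λ m → x∉U (there m)))) (sym (+-suc _ _))
... | false = ∣p∩⁅x⁆∪q∣ P U x (λ m → x∉U (there m))

module Ordering {d : ℕ} (w : Permutation′ d) where

  p : Fin d → Fin d
  p j = w ⟨$⟩ʳ j

  p-injective : ∀ {i j} → p i ≡ p j → i ≡ j
  p-injective {i} {j} e = trans (sym (inverseˡ w)) (trans (cong (w ⟨$⟩ˡ_) e) (inverseˡ w))

  ∣∩⋃⁅p⁆∣ : ∀ (P : Subset d) js → Unique js →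
    ∣ P ∩ ⋃ (map (λ j → ⁅ p j ⁆) js) ∣ ≡ ∑ js (λ j → ind (lookup P (p j)) 1)
  ∣∩⋃⁅p⁆∣ P []       []                 = trans (cong ∣_∣ (∩-zeroʳ P)) (∣⊥∣≡0 d)
  ∣∩⋃⁅p⁆∣ P (j ∷ js) (j∉js ∷ unique-js) =
    trans (∣p∩⁅x⁆∪q∣ P _ (p j) pj∉) (cong (_ +_) (∣∩⋃⁅p⁆∣ P js unique-js))
    where
    pj∉ : p j ∉ ⋃ (map (λ j → ⁅ p j ⁆) js)
    pj∉ m with ∈-⋃⁻ _ m
    ... | S , mS , pj∈S with ∈-map⁻ (λ j → ⁅ p j ⁆) mS
    ... | j′ , mj′ , refl = All.lookup j∉js mj′ (p-injective (x∈⁅y⁆⇒x≡y _ pj∈S))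

  ∣∩firstPoints∣ : ∀ (P : Subset d) k →
    ∣ P ∩ firstPoints w k ∣ ≡ ∑ (allFin d) (λ j → ind (toℕ j <ᵇ k) (ind (lookup P (p j)) 1))
  ∣∩firstPoints∣ P k =
    trans (∣∩⋃⁅p⁆∣ P _ (filterᵇ-unique _ (allFin d) (allFin⁺ d))) (∑-filterᵇ _ (allFin d) _)

  ∣∣-by-ordering : ∀ (P : Subset d) → ∣ P ∣ ≡ ∑ (allFin d) (λ j → ind (lookup P (p j)) 1)
  ∣∣-by-ordering P = trans (cong ∣_∣ (sym P∩all≡P)) (∣∩⋃⁅p⁆∣ P (allFin d) (allFin⁺ d))
    where
    P∩all≡P : P ∩ ⋃ (map (λ j → ⁅ p j ⁆) (allFin d)) ≡ P
    P∩all≡P = ⊆-antisym (p∩q⊆p _ _) λ {x} x∈P → x∈p∩q⁺ (x∈P ,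
      ∈-⋃⁺ _ (∈-map⁺ (λ j → ⁅ p j ⁆) (∈-allFin (w ⟨$⟩ˡ x)))
             (subst (_∈ ⁅ p (w ⟨$⟩ˡ x) ⁆) (inverseʳ w) (x∈⁅x⁆ _)))

  p∈firstPoints : ∀ {k} j → toℕ j < k → p j ∈ firstPoints w k
  p∈firstPoints j j<k =
    ∈-⋃⁺ _ (∈-map⁺ (λ j → ⁅ p j ⁆) (∈-filterᵇ⁺ _ (allFin d) (∈-allFin j) (<⇒<ᵇ j<k))) (x∈⁅x⁆ _)

  ∈-firstPoints⁻ : ∀ {k x} → x ∈ firstPoints w k → toℕ (w ⟨$⟩ˡ x) < k
  ∈-firstPoints⁻ {k} {x} m with ∈-⋃⁻ _ m
  ... | S , mS , x∈S with ∈-map⁻ (λ j → ⁅ p j ⁆) mS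
  ... | j , mj , refl =
    subst (λ z → toℕ z < k) (sym w⁻¹x≡j) (<ᵇ⇒< _ _ (proj₂ (∈-filterᵇ⁻ _ (allFin d) mj)))
    where
    w⁻¹x≡j : w ⟨$⟩ˡ x ≡ j
    w⁻¹x≡j = trans (cong (w ⟨$⟩ˡ_) (x∈⁅y⁆⇒x≡y (p j) x∈S)) (inverseˡ w)

  firstPoints-mono : ∀ {k k′} → k ≤ k′ → firstPoints w k ⊆ firstPoints w k′
  firstPoints-mono k≤k′ {x} m =
    subst (_∈ _) (inverseʳ w) (p∈firstPoints (w ⟨$⟩ˡ x) (≤-trans (∈-firstPoints⁻ m) k≤k′))

count : (Fin d → Bool) → ℕ
count {d} b = ∑ (allFin d) (λ j → ind (b j) 1)

countUpTo : (Fin d → Bool) → Fin d → ℕ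
countUpTo {d} b i = ∑ (allFin d) (λ j → ind (toℕ j <ᵇ suc (toℕ i)) (ind (b j) 1))

countUpTo-zero : ∀ (b : Fin (suc d) → Bool) → countUpTo b fzero ≡ ind (b fzero) 1
countUpTo-zero {d} b = trans (∑-allFin-suc (λ j → ind (toℕ j <ᵇ 1) (ind (b j) 1)))
  (trans (cong (ind (b fzero) 1 +_) (∑-zero (allFin d) (λ _ → refl))) (+-identityʳ _))

countUpTo-suc : ∀ (b : Fin (suc d) → Bool) i → countUpTo b (fsuc i) ≡ ind (b fzero) 1 + countUpTo (b ∘ fsuc) i
countUpTo-suc b i = ∑-allFin-suc (λ j → ind (toℕ j <ᵇ suc (toℕ (fsuc i))) (ind (b j) 1))

private
  crossing-at-head : ∀ β c r → ind β (ind (r <ᵇ c + ind β 1) 1) + (c ∸ r) ≡ (c + ind β 1) ∸ r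
  crossing-at-head false c r = cong (_∸ r) (sym (+-identityʳ c))
  crossing-at-head true  c r with r ≤? c
  ... | yes r≤c = begin
    ind (r <ᵇ c + 1) 1 + (c ∸ r)   ≡⟨ cong (_+ (c ∸ r)) (ind-true 1 (<⇒<ᵇ r<c+1)) ⟩
    suc (c ∸ r)                     ≡⟨ +-comm 1 (c ∸ r) ⟩
    c ∸ r + 1                       ≡⟨ +-∸-comm 1 r≤c ⟨
    c + 1 ∸ r                       ∎
    where
    open ≡-Reasoning
    r<c+1 : r < c + 1
    r<c+1 = ≤-trans (s≤s r≤c) (≤-reflexive (+-comm 1 c))
  ... | no  r≰c =
    trans (cong₂ _+_ (ind-false 1 (λ h → <⇒≱ (<ᵇ⇒< r (c + 1) h) c+1≤r)) (m≤n⇒m∸n≡0 (<⇒≤ (≰⇒> r≰c))))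
          (sym (m≤n⇒m∸n≡0 c+1≤r))
    where
    c+1≤r : c + 1 ≤ r
    c+1≤r = ≤-trans (≤-reflexive (+-comm c 1)) (≰⇒> r≰c)

  crossings-from : ∀ (b : Fin d → Bool) r c →
    ∑ (allFin d) (λ i → ind (b i) (ind (r <ᵇ c + countUpTo b i) 1)) + (c ∸ r) ≡ (c + count b) ∸ r
  crossings-from {zero}  b r c = cong (_∸ r) (sym (+-identityʳ c))
  crossings-from {suc d} b r c = begin
      ∑ (allFin (suc d)) (λ i → ind (b i) (ind (r <ᵇ c + countUpTo b i) 1)) + (c ∸ r)
    ≡⟨ cong (_+ (c ∸ r)) (trans (∑-allFin-suc (λ i → ind (b i) (ind (r <ᵇ c + countUpTo b i) 1)))
                                (cong₂ _+_ head≡ (∑-cong (allFin d) shift))) ⟩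
      ind β′ (ind (r <ᵇ c + ind β′ 1) 1) + rest + (c ∸ r)
    ≡⟨ trans (cong (_+ (c ∸ r)) (+-comm _ rest)) (+-assoc rest _ _) ⟩
      rest + (ind β′ (ind (r <ᵇ c + ind β′ 1) 1) + (c ∸ r))
    ≡⟨ cong (rest +_) (crossing-at-head β′ c r) ⟩
      rest + ((c + ind β′ 1) ∸ r)
    ≡⟨ crossings-from (b ∘ fsuc) r (c + ind β′ 1) ⟩
      (c + ind β′ 1 + count (b ∘ fsuc)) ∸ r
    ≡⟨ cong (_∸ r) (trans (+-assoc c _ _) (cong (c +_) (sym (∑-allFin-suc (λ j → ind (b j) 1))))) ⟩
      (c + count b) ∸ r
    ∎
    where
    open ≡-Reasoning
    β′ = b fzero
    rest = ∑ (allFin d) (λ i → ind (b (fsuc i)) (ind (r <ᵇ c + ind β′ 1 + countUpTo (b ∘ fsuc) i) 1))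
    head≡ : ind β′ (ind (r <ᵇ c + countUpTo b fzero) 1) ≡ ind β′ (ind (r <ᵇ c + ind β′ 1) 1)
    head≡ = cong (λ z → ind β′ (ind (r <ᵇ c + z) 1)) (countUpTo-zero b)
    shift : ∀ i → ind (b (fsuc i)) (ind (r <ᵇ c + countUpTo b (fsuc i)) 1)
                ≡ ind (b (fsuc i)) (ind (r <ᵇ c + ind β′ 1 + countUpTo (b ∘ fsuc) i) 1)
    shift i = cong (λ z → ind (b (fsuc i)) (ind (r <ᵇ z) 1))
                   (trans (cong (c +_) (countUpTo-suc b i)) (sym (+-assoc c _ _)))

-- As i runs through the marked positions in order, countUpTo grows by one at each of them,
-- so it exceeds r at exactly count b ∸ r of them.
count-exceeding : ∀ (b : Fin d → Bool) r →
  ∑ (allFin d) (λ i → ind (b i) (ind (r <ᵇ countUpTo b i) 1)) ≡ count b ∸ r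
count-exceeding {d} b r = begin
  exceeding               ≡⟨ +-identityʳ exceeding ⟨
  exceeding + 0           ≡⟨ cong (exceeding +_) (0∸n≡0 r) ⟨
  exceeding + (0 ∸ r)     ≡⟨ crossings-from b r 0 ⟩
  count b ∸ r             ∎
  where
  open ≡-Reasoning
  exceeding = ∑ (allFin d) (λ i → ind (b i) (ind (r <ᵇ countUpTo b i) 1))

-- +_ is opened only locally: in scope globally it would make sections such as (c +_) ambiguous.
module _ {A : Set} where

  open import Data.Integer using (+_; _-_)

  sumℤ-pos : ∀ xs (g : A → ℕ) → sumℤ (map (λ x → + g x) xs) ≡ + ∑ xs g
  sumℤ-pos []       g = refl
  sumℤ-pos (x ∷ xs) g = trans (cong (ℤ._+_ (+ g x)) (sumℤ-pos xs g)) (sym (ℤ.pos-+ (g x) _))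

  sumℤ-cong : ∀ xs {f g : A → ℤ} → (∀ x → f x ≡ g x) → sumℤ (map f xs) ≡ sumℤ (map g xs)
  sumℤ-cong []       h = refl
  sumℤ-cong (x ∷ xs) h = cong₂ ℤ._+_ (h x) (sumℤ-cong xs h)

  sumℤ-filterᵇ-cong : ∀ (q : A → Bool) xs {f g : A → ℤ} → (∀ x → T (q x) → f x ≡ g x) →
    sumℤ (map f (filterᵇ q xs)) ≡ sumℤ (map g (filterᵇ q xs))
  sumℤ-filterᵇ-cong q []       f≡g = refl
  sumℤ-filterᵇ-cong q (x ∷ xs) f≡g with q x in eq
  ... | true  = cong₂ ℤ._+_ (f≡g x (≡true⇒T eq)) (sumℤ-filterᵇ-cong q xs f≡g)
  ... | false = sumℤ-filterᵇ-cong q xs f≡g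

  sumℤ-const-minus : ∀ xs n (a : A → ℕ) → sumℤ (map (λ x → + n - + a x) xs) ≡ + (length xs * n) - + ∑ xs a
  sumℤ-const-minus []       n a = refl
  sumℤ-const-minus (x ∷ xs) n a
    rewrite sumℤ-const-minus xs n a | ℤ.pos-+ n (length xs * n) | ℤ.pos-+ (a x) (∑ xs a) =
    solve 4 (λ p q s t → p :- q :+ (s :- t) := p :+ s :- (q :+ t)) refl
      (+ n) (+ a x) (+ (length xs * n)) (+ ∑ xs a)
    where open +-*-Solver

  sumℤ-ranks≡n-∑deficits : ∀ xs n (r : A → ℕ) → (∀ x → r x ≤ n) →
    sumℤ (map (λ x → + r x) xs) - + n ℤ.* (+ length xs - + 1) ≡ + n - + ∑ xs (λ x → n ∸ r x)
  sumℤ-ranks≡n-∑deficits xs n r r≤n = begin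
      sumℤ (map (λ x → + r x) xs) - + n ℤ.* (+ length xs - + 1)
    ≡⟨ cong (_- + n ℤ.* (+ length xs - + 1)) (trans (sumℤ-pos xs r) R≡) ⟩
      + length xs ℤ.* + n - + D - + n ℤ.* (+ length xs - + 1)
    ≡⟨ solve 3 (λ l m e → l :* m :- e :- m :* (l :- con (+ 1)) := m :- e) refl (+ length xs) (+ n) (+ D) ⟩
      + n - + D
    ∎
    where
    open ≡-Reasoning
    open +-*-Solver
    R = ∑ xs r
    D = ∑ xs (λ x → n ∸ r x)
    R+D≡ : R + D ≡ length xs * n
    R+D≡ = trans (sym (∑-+ xs r (λ x → n ∸ r x))) (trans (∑-cong xs (λ x → m+[n∸m]≡n (r≤n x))) (∑-const xs n))
    R≡ : + R ≡ + length xs ℤ.* + n - + D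
    R≡ = begin
      + R                          ≡⟨ solve 2 (λ x y → x :+ y :- y := x) refl (+ R) (+ D) ⟨
      + R ℤ.+ + D - + D            ≡⟨ cong (_- + D) (trans (sym (ℤ.pos-+ R D)) (cong +_ R+D≡)) ⟩
      + (length xs * n) - + D      ≡⟨ cong (_- + D) (ℤ.pos-* (length xs) n) ⟩
      + length xs ℤ.* + n - + D    ∎

module _ where

  open import Data.Integer using (+_; _-_)

  +m-+n≡+[m∸n] : ∀ {m n} → n ≤ m → + m - + n ≡ + (m ∸ n)
  +m-+n≡+[m∸n] {m} {n} n≤m = trans (ℤ.m-n≡m⊖n m n) (ℤ.⊖-≥ n≤m)

  -+-antimono : ∀ N {a b} → a ≤ b → + N - + b ℤ.≤ + N - + a
  -+-antimono N a≤b = ℤ.+-monoʳ-≤ (+ N) (ℤ.neg-mono-≤ (ℤ.+≤+ a≤b))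

-- Double counting

module DoubleCounting {d : ℕ} (M : Matroid d) (n : ℕ) (rank≡n : rank M ≡ n) (w : Permutation′ d) where

  open RankProperties M
  open CircuitProperties M
  open Ordering w
  open import Data.Integer using (+_; _-_)

  -- The ground set of the restriction at which τ M n w i is computed (positions are 0-based).
  prefix : Fin d → Subset d
  prefix i = firstPoints w (suc (toℕ i))

  -- C is a small circuit of the restriction to prefix i passing through p i; its closure F in M
  -- indexes a subspace of M.
  Witness : Fin d → Subset d → Subset d → Set
  Witness i F C = IsCircuit ⊤ C × cl M ⊤ C ≡ F × C ⊆ prefix i × ∣ C ∣ ≤ rk M (prefix i) × p i ∈ C

  isWitness : Fin d → Subset d → Subset d → Bool
  isWitness i F C =
    isCircuit M ⊤ C ∧ ((cl M ⊤ C ==ˢ F) ∧ ((C ⊆ᵇ prefix i) ∧ ((∣ C ∣ ≤ᵇ rk M (prefix i)) ∧ lookup C (p i))))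

  witnessed : Fin d → Subset d → Bool
  witnessed i F = anyᵇ (isWitness i F) (allSubsets d)

  witnessed⁻ : ∀ {i F} → T (witnessed i F) → Σ (Subset d) (Witness i F)
  witnessed⁻ {i} {F} h =
    let (C , _ , isW) = anyᵇ⁻ (isWitness i F) (allSubsets d) h
        (circ , h₁) = T-∧⁻ {isCircuit M ⊤ C} isW
        (clC≡F , h₂) = T-∧⁻ {cl M ⊤ C ==ˢ F} h₁
        (C⊆ , h₃) = T-∧⁻ {C ⊆ᵇ prefix i} h₂
        (small , pi∈C) = T-∧⁻ {∣ C ∣ ≤ᵇ rk M (prefix i)} h₃
    in C , isCircuit⇒IsCircuit circ , ==ˢ⇒≡ _ _ clC≡F , ⊆ᵇ⇒⊆ _ _ C⊆ , ≤ᵇ⇒≤ _ _ small , lookup⇒∈ pi∈C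

  witnessed⁺ : ∀ {i F C} → Witness i F C → T (witnessed i F)
  witnessed⁺ {i} {F} {C} (circ , clC≡F , C⊆ , small , pi∈C) =
    anyᵇ⁺ (isWitness i F) (allSubsets d) (∈-allSubsets C)
      (T-∧⁺ (IsCircuit⇒isCircuit circ) (T-∧⁺ (≡⇒==ˢ _ _ clC≡F)
        (T-∧⁺ (⊆⇒⊆ᵇ _ _ C⊆) (T-∧⁺ (≤⇒≤ᵇ small) (∈⇒lookup pi∈C)))))

  Witness⇒InClass-prefix : ∀ {i F C} → Witness i F C → InClass (prefix i) (F ∩ prefix i) C
  Witness⇒InClass-prefix {i} ((_ , ¬iC , proper) , clC≡F , C⊆ , small , _) =
    ((C⊆ , ¬iC , proper) , small) , trans cl-restrict (cong (_∩ prefix i) clC≡F)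

  Witness⇒InClass : ∀ {i F C} → Witness i F C → InClass ⊤ F C
  Witness⇒InClass (circ , clC≡F , _ , small , _) = (circ , ≤-trans small (rk-mono ⊆⊤)) , clC≡F

  r : Subset d → ℕ
  r = subRank M ⊤

  r≤n : ∀ F → r F ≤ n
  r≤n F = subst (r F ≤_) rank≡n (subRank≤rank ⊤ F)

  localSubspacesAt : Fin d → List (Subset d)
  localSubspacesAt i = filterᵇ (λ F → lookup (points M (prefix i) F) (p i)) (subspaces M (prefix i))

  deficitAt : Fin d → ℕ
  deficitAt i = ∑ (localSubspacesAt i) (λ F → n ∸ subRank M (prefix i) F)

  -- A subspace of the restriction to prefix i containing p i is the trace F ∩ prefix i of exactly one
  -- subspace F of M witnessed at i, and both have the same rank.
  deficitAt-by-subspaces : ∀ i →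
    deficitAt i ≡ ∑ (allSubsets d) (λ F → ind (isSubspace ⊤ F ∧ witnessed i F) (n ∸ r F))
  deficitAt-by-subspaces i = begin
      deficitAt i
    ≡⟨ ∑-filterᵇ _ (subspaces M E) _ ⟩
      ∑ (subspaces M E) (λ F → ind (lookup (points M E F) (p i)) (n ∸ subRank M E F))
    ≡⟨ ∑-filterᵇ _ (allSubsets d) _ ⟩
      ∑ (allSubsets d) (λ F → ind (isSubspace E F) (ind (lookup (points M E F) (p i)) (n ∸ subRank M E F)))
    ≡⟨ ∑-cong (allSubsets d) (λ F → ind-∧ (isSubspace E F) _ _) ⟩
      ∑ (allSubsets d) (λ F → ind (isSubspace E F ∧ lookup (points M E F) (p i)) (n ∸ subRank M E F))
    ≡⟨ ∑-allSubsets-reindex _ _ (_∩ E) _ _ into onto injective same-rank ⟩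
      ∑ (allSubsets d) (λ F → ind (isSubspace ⊤ F ∧ witnessed i F) (n ∸ r F))
    ∎
    where
    open ≡-Reasoning
    E = prefix i

    into : ∀ F → T (isSubspace ⊤ F ∧ witnessed i F) →
           T (isSubspace E (F ∩ E) ∧ lookup (points M E (F ∩ E)) (p i))
    into F h with witnessed⁻ (proj₂ (T-∧⁻ {isSubspace ⊤ F} h))
    ... | C , W@(_ , _ , _ , _ , pi∈C) =
      T-∧⁺ (isSubspace⁺ (Witness⇒InClass-prefix W)) (∈⇒lookup (∈-points⁺ (Witness⇒InClass-prefix W) pi∈C))

    onto : ∀ X → T (isSubspace E X ∧ lookup (points M E X) (p i)) →
           Σ (Subset d) λ F → T (isSubspace ⊤ F ∧ witnessed i F) × F ∩ E ≡ X
    onto X h with ∈-points⁻ {E} {X} (lookup⇒∈ (proj₂ (T-∧⁻ {isSubspace E X} h)))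
    ... | C , (((C⊆E , ¬iC , proper) , small) , clC≡X) , pi∈C =
      let W : Witness i (cl M ⊤ C) C
          W = (⊆⊤ , ¬iC , proper) , refl , C⊆E , small , pi∈C
      in cl M ⊤ C , T-∧⁺ (isSubspace⁺ (Witness⇒InClass W)) (witnessed⁺ W) , trans (sym cl-restrict) clC≡X

    injective : ∀ F₁ F₂ → T (isSubspace ⊤ F₁ ∧ witnessed i F₁) → T (isSubspace ⊤ F₂ ∧ witnessed i F₂) →
                F₁ ∩ E ≡ F₂ ∩ E → F₁ ≡ F₂
    injective F₁ F₂ h₁ h₂ F₁∩E≡F₂∩E =
      let (C₁ , (_ , cl₁ , C₁⊆ , _)) = witnessed⁻ (proj₂ (T-∧⁻ {isSubspace ⊤ F₁} h₁))
          (C₂ , (_ , cl₂ , C₂⊆ , _)) = witnessed⁻ (proj₂ (T-∧⁻ {isSubspace ⊤ F₂} h₂))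
      in trans (sym cl₁) (trans (cl-∩-injective C₁⊆ C₂⊆
           (trans (cong (_∩ E) cl₁) (trans F₁∩E≡F₂∩E (cong (_∩ E) (sym cl₂))))) cl₂)

    same-rank : ∀ F → T (isSubspace ⊤ F ∧ witnessed i F) → n ∸ subRank M E (F ∩ E) ≡ n ∸ r F
    same-rank F h = let (C , W) = witnessed⁻ (proj₂ (T-∧⁻ {isSubspace ⊤ F} h)) in
      cong (n ∸_) (trans (subRank≡rk (Witness⇒InClass-prefix W)) (sym (subRank≡rk (Witness⇒InClass W))))

  τ≡n-deficitAt : ∀ i → τ M n w i ≡ + n - + deficitAt i
  τ≡n-deficitAt i = sumℤ-ranks≡n-∑deficits (localSubspacesAt i) n (subRank M (prefix i))
    (λ F → subst (subRank M (prefix i) F ≤_) rank≡n (subRank≤rank (prefix i) F))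

  sumτ≡nd-∑deficitAt : sumτ M n w ≡ + (n * d) - + ∑ (allFin d) deficitAt
  sumτ≡nd-∑deficitAt = begin
      sumτ M n w
    ≡⟨ sumℤ-cong (allFin d) τ≡n-deficitAt ⟩
      sumℤ (map (λ i → + n - + deficitAt i) (allFin d))
    ≡⟨ sumℤ-const-minus (allFin d) n deficitAt ⟩
      + (length (allFin d) * n) - + ∑ (allFin d) deficitAt
    ≡⟨ cong (λ k → + k - + ∑ (allFin d) deficitAt)
            (trans (cong (_* n) (length-tabulate {n = d} (λ x → x))) (*-comm d n)) ⟩
      + (n * d) - + ∑ (allFin d) deficitAt
    ∎
    where open ≡-Reasoning

  size : Subset d → ℕ
  size = subSize M ⊤

  excess : ℕ
  excess = ∑ (subspaces M ⊤) (λ F → (size F ∸ r F) * (n ∸ r F))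

  dimNaive≡nd-excess : dimNaive M n ≡ + (n * d) - + excess
  dimNaive≡nd-excess = cong (_-_ (+ (n * d))) (trans
    (sumℤ-filterᵇ-cong (isSubspace ⊤) (allSubsets d) λ F h →
      trans (cong₂ ℤ._*_ (+m-+n≡+[m∸n] (subRank≤subSize h)) (+m-+n≡+[m∸n] (r≤n F)))
            (sym (ℤ.pos-* (size F ∸ r F) (n ∸ r F))))
    (sumℤ-pos (subspaces M ⊤) (λ F → (size F ∸ r F) * (n ∸ r F))))

  witnessCount : Subset d → ℕ
  witnessCount F = ∑ (allFin d) (λ i → ind (witnessed i F) 1)

  ∑deficitAt-by-witnessCount :
    ∑ (allFin d) deficitAt ≡ ∑ (allSubsets d) (λ F → ind (isSubspace ⊤ F) ((n ∸ r F) * witnessCount F))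
  ∑deficitAt-by-witnessCount = trans (∑-cong (allFin d) deficitAt-by-subspaces)
    (trans (∑-swap (allFin d) (allSubsets d) _) (∑-cong (allSubsets d) per-subspace))
    where
    per-subspace : ∀ F → ∑ (allFin d) (λ i → ind (isSubspace ⊤ F ∧ witnessed i F) (n ∸ r F))
                         ≡ ind (isSubspace ⊤ F) ((n ∸ r F) * witnessCount F)
    per-subspace F with isSubspace ⊤ F
    ... | false = ∑-zero (allFin d) (λ _ → refl)
    ... | true  = trans (∑-cong (allFin d) (λ i → ind-* (witnessed i F) (n ∸ r F))) (∑-*ˡ (allFin d) (n ∸ r F) _)

  excess-by-subspaces : excess ≡ ∑ (allSubsets d) (λ F → ind (isSubspace ⊤ F) ((n ∸ r F) * (size F ∸ r F)))
  excess-by-subspaces = trans (∑-filterᵇ _ (allSubsets d) _)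
    (∑-cong (allSubsets d) (λ F → cong (ind (isSubspace ⊤ F)) (*-comm (size F ∸ r F) (n ∸ r F))))

  onSubspace : Subset d → Fin d → Bool
  onSubspace F j = lookup (points M ⊤ F) (p j)

  countUpTo-onSubspace : ∀ F i → countUpTo (onSubspace F) i ≡ ∣ points M ⊤ F ∩ prefix i ∣
  countUpTo-onSubspace F i = sym (∣∩firstPoints∣ (points M ⊤ F) (suc (toℕ i)))

  Crossing : Subset d → Fin d → Set
  Crossing F i = p i ∈ points M ⊤ F × r F < ∣ points M ⊤ F ∩ prefix i ∣

  crossing⇒T : ∀ {F i} → Crossing F i → T (onSubspace F i) × T (r F <ᵇ countUpTo (onSubspace F) i)
  crossing⇒T {F} {i} (pi∈ , r<) = ∈⇒lookup pi∈ , <⇒<ᵇ (subst (r F <_) (sym (countUpTo-onSubspace F i)) r<)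

  T⇒crossing : ∀ {F i} → T (onSubspace F i) → T (r F <ᵇ countUpTo (onSubspace F) i) → Crossing F i
  T⇒crossing {F} {i} pi∈ r< = lookup⇒∈ pi∈ , subst (r F <_) (countUpTo-onSubspace F i) (<ᵇ⇒< _ _ r<)

  crossings : Subset d → ℕ
  crossings F = ∑ (allFin d) (λ i → ind (onSubspace F i) (ind (r F <ᵇ countUpTo (onSubspace F) i) 1))

  crossings≡ : ∀ F → crossings F ≡ size F ∸ r F
  crossings≡ F =
    trans (count-exceeding (onSubspace F) (r F)) (cong (_∸ r F) (sym (∣∣-by-ordering (points M ⊤ F))))

  witnessed⇒crossing : ∀ {F i} → T (witnessed i F) → Crossing F i
  witnessed⇒crossing {F} {i} h with witnessed⁻ h
  ... | C , W@((_ , ¬iC , _) , _ , C⊆ , _ , pi∈C) = ∈-points⁺ inClass pi∈C , (begin-strict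
      r F                              ≡⟨ subRank≡rk inClass ⟩
      rk M C                           <⟨ dep⇒rk<∣∣ ¬iC ⟩
      ∣ C ∣                            ≤⟨ p⊆q⇒∣p∣≤∣q∣ C⊆l∩prefix ⟩
      ∣ points M ⊤ F ∩ prefix i ∣      ∎)
    where
    open ≤-Reasoning
    inClass = Witness⇒InClass W
    C⊆l∩prefix : C ⊆ points M ⊤ F ∩ prefix i
    C⊆l∩prefix x∈C = x∈p∩q⁺ (∈-points⁺ inClass x∈C , C⊆ x∈C)

  AllCrossingsWitnessed : Set
  AllCrossingsWitnessed = ∀ F → T (isSubspace ⊤ F) → ∀ i → Crossing F i → T (witnessed i F)

  ∑deficitAt≤excess : ∑ (allFin d) deficitAt ≤ excess
  ∑deficitAt≤excess =
    subst₂ _≤_ (sym ∑deficitAt-by-witnessCount) (sym excess-by-subspaces) (∑-mono (allSubsets d) per-subspace)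
    where
    per-subspace : ∀ F → ind (isSubspace ⊤ F) ((n ∸ r F) * witnessCount F)
                       ≤ ind (isSubspace ⊤ F) ((n ∸ r F) * (size F ∸ r F))
    per-subspace F with isSubspace ⊤ F
    ... | false = z≤n
    ... | true  = *-monoʳ-≤ (n ∸ r F) (begin
      witnessCount F   ≤⟨ ∑-mono (allFin d) (λ i → ind-1-≤ (crossing⇒T ∘ witnessed⇒crossing)) ⟩
      crossings F      ≡⟨ crossings≡ F ⟩
      size F ∸ r F     ∎)
      where open ≤-Reasoning

  ∑deficitAt≡excess : AllCrossingsWitnessed → ∑ (allFin d) deficitAt ≡ excess
  ∑deficitAt≡excess all-witnessed =
    trans ∑deficitAt-by-witnessCount (trans (∑-cong (allSubsets d) per-subspace) (sym excess-by-subspaces))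
    where
    per-subspace : ∀ F → ind (isSubspace ⊤ F) ((n ∸ r F) * witnessCount F)
                       ≡ ind (isSubspace ⊤ F) ((n ∸ r F) * (size F ∸ r F))
    per-subspace F with isSubspace ⊤ F in eq
    ... | false = refl
    ... | true  = cong ((n ∸ r F) *_) (trans
      (∑-cong (allFin d) (λ i → ind-1-≡ (crossing⇒T ∘ witnessed⇒crossing)
                                         (λ b c → all-witnessed F (≡true⇒T eq) i (T⇒crossing b c))))
      (crossings≡ F))

  dimNaive≤sumτ : dimNaive M n ℤ.≤ sumτ M n w
  dimNaive≤sumτ =
    subst₂ ℤ._≤_ (sym dimNaive≡nd-excess) (sym sumτ≡nd-∑deficitAt) (-+-antimono (n * d) ∑deficitAt≤excess)

  dimNaive≡sumτ : AllCrossingsWitnessed → dimNaive M n ≡ sumτ M n w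
  dimNaive≡sumτ all-witnessed = begin
    dimNaive M n                        ≡⟨ dimNaive≡nd-excess ⟩
    + (n * d) - + excess                ≡⟨ cong (λ k → + (n * d) - + k) (∑deficitAt≡excess all-witnessed) ⟨
    + (n * d) - + ∑ (allFin d) deficitAt ≡⟨ sumτ≡nd-∑deficitAt ⟨
    sumτ M n w                          ∎
    where open ≡-Reasoning

-- Elementary split matroids

module ElementarySplitCrossings
  {d : ℕ} (M : Matroid d) (n : ℕ) (rank≡n : rank M ≡ n) (w : Permutation′ d) (basis : IsBasis M (firstPoints w n))
  {q : ℕ} (H : Fin q → Subset d) (ρ : Fin q → ℕ) (ρ≥1 : ∀ j → 1 ≤ ρ j)
  (overlap-bound : ∀ j k → ¬ (j ≡ k) → ∣ H j ∩ H k ∣ + n ≤ ρ j + ρ k)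
  (ρ≤n∸1 : ∀ j → ρ j ≤ n ∸ 1)
  (indep⇔ : ∀ X → (Indep M X → (∣ X ∣ ≤ n × (∀ j → ∣ X ∩ H j ∣ ≤ ρ j)))
                × ((∣ X ∣ ≤ n × (∀ j → ∣ X ∩ H j ∣ ≤ ρ j)) → Indep M X))
  where

  open RankProperties M
  open CircuitProperties M
  open Ordering w
  open DoubleCounting M n rank≡n w

  ρ<n : ∀ j → ρ j < n
  ρ<n j = subst (_≤ n) (+-comm (ρ j) 1) (m≤o∸n⇒m+n≤o (ρ j) 1≤n (ρ≤n∸1 j))
    where 1≤n = ≤-trans (ρ≥1 j) (≤-trans (ρ≤n∸1 j) (m∸n≤m n 1))

  overlap-< : ∀ {j k} → j ≢ k → ∣ H j ∩ H k ∣ < ρ k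
  overlap-< {j} {k} j≢k = +-cancelʳ-< n _ _ (begin-strict
    ∣ H j ∩ H k ∣ + n   ≤⟨ overlap-bound j k j≢k ⟩
    ρ j + ρ k           <⟨ +-monoˡ-< (ρ k) (ρ<n j) ⟩
    n + ρ k             ≡⟨ +-comm n (ρ k) ⟩
    ρ k + n             ∎)
    where open ≤-Reasoning

  indep⇒∣∩H∣≤ρ : ∀ {X} → Indep M X → ∀ j → ∣ X ∩ H j ∣ ≤ ρ j
  indep⇒∣∩H∣≤ρ {X} iX = proj₂ (proj₁ (indep⇔ X) iX)

  rk≤ρ : ∀ j {X} → X ⊆ H j → rk M X ≤ ρ j
  rk≤ρ j {X} X⊆H = let (Y , iY , Y⊆X , ∣Y∣≡) = rk-witness X in
    subst (_≤ ρ j) (trans (cong ∣_∣ (p⊆q⇒p∩q≡p (⊆-trans Y⊆X X⊆H))) ∣Y∣≡) (indep⇒∣∩H∣≤ρ iY j)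

  ⊆H∧∣∣≤ρ⇒indep : ∀ j {Y} → Y ⊆ H j → ∣ Y ∣ ≤ ρ j → Indep M Y
  ⊆H∧∣∣≤ρ⇒indep j {Y} Y⊆H ∣Y∣≤ρ = proj₂ (indep⇔ Y) (≤-trans ∣Y∣≤ρ (<⇒≤ (ρ<n j)) , per-H)
    where
    per-H : ∀ k → ∣ Y ∩ H k ∣ ≤ ρ k
    per-H k with k ≟ᶠ j
    ... | yes refl = ≤-trans (∣p∩q∣≤∣p∣ Y (H k)) ∣Y∣≤ρ
    ... | no  k≢j  = ≤-trans (p⊆q⇒∣p∣≤∣q∣ (λ h → let (y∈Y , y∈H) = x∈p∩q⁻ _ _ h in x∈p∩q⁺ (Y⊆H y∈Y , y∈H)))
                             (<⇒≤ (overlap-< (k≢j ∘ sym)))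

  full-in-H-∪⁅outside⁆-indep : ∀ j {I x} → I ⊆ H j → ∣ I ∣ ≡ ρ j → x ∉ H j → Indep M (I ∪ ⁅ x ⁆)
  full-in-H-∪⁅outside⁆-indep j {I} {x} I⊆H ∣I∣≡ρ x∉H =
    proj₂ (indep⇔ (I ∪ ⁅ x ⁆))
      (≤-trans (∣p∪⁅x⁆∣≤1+∣p∣ I x) (subst (λ k → suc k ≤ n) (sym ∣I∣≡ρ) (ρ<n j)) , per-H)
    where
    per-H : ∀ k → ∣ (I ∪ ⁅ x ⁆) ∩ H k ∣ ≤ ρ k
    per-H k with k ≟ᶠ j
    ... | yes refl = ≤-trans (p⊆q⇒∣p∣≤∣q∣ ⊆I) (≤-reflexive ∣I∣≡ρ)
      where
      ⊆I : (I ∪ ⁅ x ⁆) ∩ H k ⊆ I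
      ⊆I h with x∈p∩q⁻ _ _ h
      ... | y∈I∪x , y∈H with x∈p∪q⁻ I ⁅ x ⁆ y∈I∪x
      ... | inj₁ y∈I   = y∈I
      ... | inj₂ y∈⁅x⁆ = ⊥-elim (x∉H (subst (_∈ H k) (x∈⁅y⁆⇒x≡y x y∈⁅x⁆) y∈H))
    ... | no  k≢j  = ≤-trans (p⊆q⇒∣p∣≤∣q∣ ⊆overlap+x)
                       (≤-trans (∣p∪⁅x⁆∣≤1+∣p∣ (H j ∩ H k) x) (overlap-< (λ j≡k → k≢j (sym j≡k))))
      where
      ⊆overlap+x : (I ∪ ⁅ x ⁆) ∩ H k ⊆ (H j ∩ H k) ∪ ⁅ x ⁆
      ⊆overlap+x h with x∈p∩q⁻ _ _ h
      ... | y∈I∪x , y∈H with x∈p∪q⁻ I ⁅ x ⁆ y∈I∪x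
      ... | inj₁ y∈I   = x∈p∪q⁺ (inj₁ (x∈p∩q⁺ (I⊆H y∈I , y∈H)))
      ... | inj₂ y∈⁅x⁆ = x∈p∪q⁺ (inj₂ y∈⁅x⁆)

  cl≡H : ∀ j {C} → C ⊆ H j → ρ j ≤ rk M C → cl M ⊤ C ≡ H j
  cl≡H j {C} C⊆H ρ≤rk = ⊆-antisym cl⊆H H⊆cl
    where
    rk≡ρ : rk M C ≡ ρ j
    rk≡ρ = ≤-antisym (rk≤ρ j C⊆H) ρ≤rk
    cl⊆H : cl M ⊤ C ⊆ H j
    cl⊆H {x} x∈cl with x ∈? H j
    ... | yes x∈H = x∈H
    ... | no  x∉H = let (I , iI , I⊆C , ∣I∣≡) = rk-witness C in
      ⊥-elim (full-rank-maximal (⊆-trans I⊆C (p⊆p∪q _)) (trans ∣I∣≡ (sym (proj₂ (∈-cl⁻ ⊤ C x∈cl))))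
                                (x∈p∪q⁺ (inj₂ (x∈⁅x⁆ x))) (x∉H ∘ C⊆H ∘ I⊆C)
                                (full-in-H-∪⁅outside⁆-indep j (⊆-trans I⊆C C⊆H) (trans ∣I∣≡ rk≡ρ) x∉H))
    H⊆cl : H j ⊆ cl M ⊤ C
    H⊆cl x∈H = ∈-cl⁺ ⊤ C ∈⊤
      (≤-antisym (≤-trans (rk≤ρ j (∪⁅⁆-least C⊆H x∈H)) (≤-reflexive (sym rk≡ρ))) (rk-mono (p⊆p∪q _)))

  circuit-ρ≤rk : ∀ j {C} → IsCircuit ⊤ C → ρ j < ∣ C ∣ → ρ j ≤ rk M C
  circuit-ρ≤rk j {C} (_ , _ , proper) ρ<∣C∣ = let (Y , Y⊆C , ∣Y∣≡ρ) = subset-of-size C (ρ j) (<⇒≤ ρ<∣C∣) in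
    subst (_≤ rk M C) ∣Y∣≡ρ
      (indep⇒∣∣≤rk (proper Y Y⊆C (λ Y≡C → <-irrefl (trans (sym ∣Y∣≡ρ) (cong ∣_∣ Y≡C)) ρ<∣C∣)) Y⊆C)

  small-circuit⊆H : ∀ {C} → IsCircuit ⊤ C → ∣ C ∣ ≤ n → Σ (Fin q) λ j → C ⊆ H j × ρ j < ∣ C ∣
  small-circuit⊆H {C} (_ , ¬iC , proper) ∣C∣≤n =
    let (j , ¬∣C∩H∣≤ρ) = ¬∀⟶∃¬ q (λ k → ∣ C ∩ H k ∣ ≤ ρ k) (λ k → ∣ C ∩ H k ∣ ≤? ρ k)
                                 (λ all≤ → ¬iC (proj₂ (indep⇔ C) (∣C∣≤n , all≤)))
        C∩H≡C = C∩H≡C-of j ¬∣C∩H∣≤ρ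
    in j , (λ x∈C → proj₂ (x∈p∩q⁻ C (H j) (subst (_ ∈_) (sym C∩H≡C) x∈C)))
         , subst (ρ j <_) (cong ∣_∣ C∩H≡C) (≰⇒> ¬∣C∩H∣≤ρ)
    where
    C∩H≡C-of : ∀ j → ¬ (∣ C ∩ H j ∣ ≤ ρ j) → C ∩ H j ≡ C
    C∩H≡C-of j ¬≤ with ≡-dec _≟ᵇ_ (C ∩ H j) C
    ... | yes C∩H≡C = C∩H≡C
    ... | no  C∩H≢C = ⊥-elim (¬≤ (subst (_≤ ρ j) (cong ∣_∣ (p⊆q⇒p∩q≡p (p∩q⊆q C (H j))))
                                    (indep⇒∣∩H∣≤ρ (proper (C ∩ H j) (p∩q⊆p C (H j)) C∩H≢C) j)))

  ρ+1-subset-of-H-circuit : ∀ j {S} → S ⊆ H j → ∣ S ∣ ≡ suc (ρ j) → IsCircuit ⊤ S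
  ρ+1-subset-of-H-circuit j {S} S⊆H ∣S∣≡ = ⊆⊤ , ¬iS , proper
    where
    ¬iS : ¬ Indep M S
    ¬iS iS = n≮n (ρ j) (subst (_≤ ρ j) ∣S∣≡
      (subst (_≤ ρ j) (cong ∣_∣ (p⊆q⇒p∩q≡p S⊆H)) (indep⇒∣∩H∣≤ρ iS j)))
    proper : ∀ Y → Y ⊆ S → Y ≢ S → Indep M Y
    proper Y Y⊆S Y≢S =
      ⊆H∧∣∣≤ρ⇒indep j (⊆-trans Y⊆S S⊆H) (≤-pred (subst (∣ Y ∣ <_) ∣S∣≡ (p⊆q∧p≢q⇒∣p∣<∣q∣ Y⊆S Y≢S)))

  n≤∣basis∣ : n ≤ ∣ firstPoints w n ∣
  n≤∣basis∣ with ≤-<-connex n ∣ firstPoints w n ∣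
  ... | inj₁ n≤ = n≤
  ... | inj₂ ∣B∣<n with rk-witness ⊤
  ... | J , iJ , _ , ∣J∣≡ with augment M _ J (proj₁ basis) iJ (subst (_ <_) (sym (trans ∣J∣≡ rank≡n)) ∣B∣<n)
  ... | z , _ , z∉B , iBz = ⊥-elim (proj₂ basis z z∉B iBz)

  -- Before position n the prefix lies inside the basis, so it contains no dependent set at all.
  dependent-in-prefix-small : ∀ i {S} → S ⊆ prefix i → ¬ Indep M S → ∣ S ∣ ≤ n → ∣ S ∣ ≤ rk M (prefix i)
  dependent-in-prefix-small i {S} S⊆ ¬iS ∣S∣≤n with suc (toℕ i) ≤? n
  ... | yes i<n = ⊥-elim (¬iS (hered M _ S (⊆-trans S⊆ (firstPoints-mono i<n)) (proj₁ basis)))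
  ... | no  i≮n = begin
    ∣ S ∣                   ≤⟨ ∣S∣≤n ⟩
    n                       ≤⟨ n≤∣basis∣ ⟩
    ∣ firstPoints w n ∣     ≡⟨ indep⇒rk≡∣∣ (proj₁ basis) ⟨
    rk M (firstPoints w n)  ≤⟨ rk-mono (firstPoints-mono (<⇒≤ (≰⇒> i≮n))) ⟩
    rk M (prefix i)         ∎
    where open ≤-Reasoning

  points-⊆ : ∀ {F} → points M ⊤ F ⊆ F
  points-⊆ {F} x∈ = let (C , ((_ , _) , clC≡F) , x∈C) = ∈-points⁻ {⊤} {F} x∈ in
    subst (_ ∈_) clC≡F (⊆-cl ⊆⊤ x∈C)

  subspace-is-H : ∀ {F} → T (isSubspace ⊤ F) → Σ (Fin q) λ j → F ≡ H j × r F ≡ ρ j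
  subspace-is-H isSub with isSubspace⁻ isSub
  ... | C , inClass@((circ , small) , clC≡F) with small-circuit⊆H circ (subst (∣ C ∣ ≤_) rank≡n small)
  ... | j , C⊆H , ρ<∣C∣ =
    j , trans (sym clC≡F) (cl≡H j C⊆H ρ≤rkC) , trans (subRank≡rk inClass) (≤-antisym (rk≤ρ j C⊆H) ρ≤rkC)
    where
    ρ≤rkC : ρ j ≤ rk M C
    ρ≤rkC = circuit-ρ≤rk j circ ρ<∣C∣

  -- Any ρ j + 1 points of F ∩ prefix i including p i form the required circuit.
  crossing-of-H-witnessed : ∀ j {F} → F ≡ H j → r F ≡ ρ j → ∀ i → Crossing F i → T (witnessed i F)
  crossing-of-H-witnessed j {F} F≡H rF≡ρ i (pi∈ , r<)
    with subset-of-size-∋ (points M ⊤ F ∩ prefix i) (ρ j) (x∈p∩q⁺ (pi∈ , p∈firstPoints i (n<1+n _)))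
                          (subst (_< ∣ points M ⊤ F ∩ prefix i ∣) rF≡ρ r<)
  ... | S , S⊆ , pi∈S , ∣S∣≡ = witnessed⁺ (circS , clS≡F , S⊆prefix , small , pi∈S)
    where
    S⊆H : S ⊆ H j
    S⊆H x∈S = subst (_ ∈_) F≡H (points-⊆ (proj₁ (x∈p∩q⁻ _ _ (S⊆ x∈S))))
    S⊆prefix : S ⊆ prefix i
    S⊆prefix x∈S = proj₂ (x∈p∩q⁻ _ _ (S⊆ x∈S))
    circS : IsCircuit ⊤ S
    circS = ρ+1-subset-of-H-circuit j S⊆H ∣S∣≡
    clS≡F : cl M ⊤ S ≡ F
    clS≡F = trans (cl≡H j S⊆H (circuit-ρ≤rk j circS (subst (ρ j <_) (sym ∣S∣≡) (n<1+n _)))) (sym F≡H)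
    small : ∣ S ∣ ≤ rk M (prefix i)
    small = dependent-in-prefix-small i S⊆prefix (proj₁ (proj₂ circS)) (subst (_≤ n) (sym ∣S∣≡) (ρ<n j))

  allCrossingsWitnessed : AllCrossingsWitnessed
  allCrossingsWitnessed F isSub = let (j , F≡H , rF≡ρ) = subspace-is-H isSub in crossing-of-H-witnessed j F≡H rF≡ρ

proposition4p4 : ∀ {d n : ℕ} (M : Matroid d) → rank M ≡ n →
    (w : Permutation′ d) → IsBasis M (firstPoints w n) →
    (dimNaive M n ℤ.≤ sumτ M n w) × (IsElementarySplit M n → dimNaive M n ≡ sumτ M n w)
proposition4p4 {d} {n} M rank≡n w basis = dimNaive≤sumτ , split-equality
  where
  open DoubleCounting M n rank≡n w
  split-equality : IsElementarySplit M n → dimNaive M n ≡ sumτ M n w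
  split-equality (q , H , ρ , ρ≥1 , overlap-bound , _ , ρ≤n∸1 , _ , indep⇔) =
    dimNaive≡sumτ (allCrossingsWitnessed H ρ ρ≥1 overlap-bound ρ≤n∸1 indep⇔)
    where open ElementarySplitCrossings M n rank≡n w basis
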